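{- Let $n,m,m'\ge 1$ be integers and let $T=1^{k_1} i_2^{k_2}\cdots i_r^{k_r}$ be a type with $r\ge 2$, $1<i_2<\cdots<i_r$, all $k_j\ge 1$, $n=k_1+\sum_{j=2}^r k_j i_j$, satisfying \[ \left\lceil\frac{k_1}{k_2+\cdots+k_r}\right\rceil\ge (\max\{m,m'\}-1)(i_r-1). \] Given an $m$-AP-partition $\pi$ of $\mathbb{Z}_n$ of type $T$, the separation algorithm $\psi$ (described in the context) produces the same $m'$-AP-partition $\psi(\pi)$ no matter which head $h_1$ with $g(h_1)$ maximum is chosen as the starting point.
   Context: $\mathbb{Z}_n$ has elements $1,\ldots,n$ placed clockwise on a directed cycle. An $m$-AP-block of length $i$ is a sequence $(x,x+m,\ldots,x+(i-1)m)\pmod n$ of $i$ distinct elements; $x$ is its head; a block of length 1 is a singleton. An $m$-AP-partition is a set of $m$-AP-blocks whose underlying sets partition $\mathbb{Z}_n$; its type is $1^{k_1}i_2^{k_2}\cdots i_r^{k_r}$ if it has $k_1$ blocks of length 1 and $k_j$ blocks of length $i_j$. For an $m$-AP-partition $\pi$ and a head $h$ of $\pi$, let $h^*$ be the first head of a non-singleton block of $\pi$ met among $h-1,h-2,\ldots,h-n \pmod n$, and let $g(h)$ be the number of singleton elements on the path $h^*, h^*+1,\ldots,h$, not counting $h$. Separation algorithm $\psi$: given $\pi$, choose a head $h_1$ of $\pi$ with $g(h_1)$ maximum (the starting point), and linearly order $\mathbb{Z}_n$ as $h_1<h_1+1<\cdots<h_1-1 \pmod n$. List the heads of $\pi$ as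 $h_1<\cdots<h_t$ in this order, let $B_i$ be the block with head $h_i$ and $l_i$ its length. Put $h_1'=h_1$, $B_1'=(h_1',h_1'+m',\ldots,h_1'+(l_1-1)m')$; for $i=2,\ldots,t$, let $h_i'$ be the smallest element not lying in $B_1',\ldots,B_{i-1}'$ and $B_i'=(h_i',h_i'+m',\ldots,h_i'+(l_i-1)m')$. Set $\psi(\pi)=\{B_1',\ldots,B_t'\}$; under the stated condition this is an $m'$-AP-partition of type $T$. -}

module Defs where

open import Data.Bool using (Bool; true; false; _∧_; if_then_else_; not)
open import Data.Nat using (ℕ; zero; suc; _+_; _*_; _∸_; _≤_; _<_; _≡ᵇ_; _≤ᵇ_; _⊔_; NonZero)
open import Data.Nat.DivMod using (_%_; _/_)
open import Data.List using (List; []; _∷_; map; upTo; length; filterᵇ; foldr; _++_)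
open import Data.Bool.ListAction using (any)
open import Data.List.Relation.Binary.Permutation.Propositional using (_↭_)
open import Data.List.Relation.Unary.All using (All)
open import Data.List.Relation.Unary.Linked using (Linked)
open import Data.List.Membership.Propositional using (_∈_)
open import Data.List.Relation.Unary.Any using (Any)
open import Data.Sum using (_⊎_)
open import Relation.Binary.PropositionalEquality using (_≡_; _≢_)
open import Function.Bundles using (_⇔_)
open import Data.Product using (_×_; _,_; proj₁; proj₂)

-- Elements of ℤ_n are represented by the naturals 0 … n-1 (the paper's
-- label n corresponds to 0); x + 1 is the clockwise successor, taken mod n.

-- A block is represented by (head , length); for a fixed step m it denotes
-- the sequence (x, x+m, …, x+(l-1)m) mod n.
Block : Set
Block = ℕ × ℕ

blockElems : (n m : ℕ) → .{{NonZero n}} → Block → List ℕ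
blockElems n m (x , l) = map (λ j → (x + j * m) % n) (upTo l)

allElems : (n m : ℕ) → .{{NonZero n}} → List Block → List ℕ
allElems n m [] = []
allElems n m (b ∷ bs) = blockElems n m b ++ allElems n m bs

countLen : ℕ → List Block → ℕ
countLen i π = length (filterᵇ (λ b → proj₂ b ≡ᵇ i) π)

-- ceiling of a / b (b ≥ 1 in all uses)
ceilDiv : ℕ → ℕ → ℕ
ceilDiv a zero = 0
ceilDiv a (suc b) = (a + b) / suc b

maxLen : List (ℕ × ℕ) → ℕ
maxLen ts = foldr (λ p acc → proj₁ p ⊔ acc) 0 ts

isSingleton : List Block → ℕ → Bool
isSingleton π y = any (λ b → (proj₁ b ≡ᵇ y) ∧ (proj₂ b ≡ᵇ 1)) π

isNonSingHead : List Block → ℕ → Bool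
isNonSingHead π y = any (λ b → (proj₁ b ≡ᵇ y) ∧ (2 ≤ᵇ proj₂ b)) π

findFirst : (ℕ → Bool) → List ℕ → ℕ → ℕ
findFirst p [] d = d
findFirst p (j ∷ js) d = if p j then j else findFirst p js d

minusMod : (n : ℕ) → .{{NonZero n}} → ℕ → ℕ → ℕ
minusMod n h j = (h + (n ∸ j)) % n

oneTo : ℕ → List ℕ
oneTo k = map suc (upTo k)

-- d(h) : the least d ∈ {1,…,n} such that h - d is the head of a non-singleton
-- block, so that h* = h - d
distPrev : (n : ℕ) → .{{NonZero n}} → List Block → ℕ → ℕ
distPrev n π h = findFirst (λ j → isNonSingHead π (minusMod n h j)) (oneTo n) n

-- g(h) : number of singleton elements on the path h*, h*+1, …, h, not counting h,
-- i.e. among h-d, …, h-1 where d = distPrev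
g : (n : ℕ) → .{{NonZero n}} → List Block → ℕ → ℕ
g n π h = length (filterᵇ (λ j → isSingleton π (minusMod n h j)) (oneTo (distPrev n π h)))

elemᵇ : ℕ → List ℕ → Bool
elemᵇ x xs = any (λ y → y ≡ᵇ x) xs

orderFrom : (n : ℕ) → .{{NonZero n}} → ℕ → List ℕ
orderFrom n s = map (λ k → (s + k) % n) (upTo n)

-- lengths l_1, …, l_t of the blocks of π, listed by heads in the order from s
lengthsFrom : (n : ℕ) → .{{NonZero n}} → List Block → ℕ → List ℕ
lengthsFrom n π s =
  foldr (λ x acc → map proj₂ (filterᵇ (λ b → proj₁ b ≡ᵇ x) π) ++ acc) [] (orderFrom n s)

firstFree : (n : ℕ) → .{{NonZero n}} → ℕ → List ℕ → ℕ
firstFree n s cov = findFirst (λ x → not (elemᵇ x cov)) (orderFrom n s) s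

psiGo : (n m' : ℕ) → .{{NonZero n}} → ℕ → List ℕ → List ℕ → List Block
psiGo n m' s cov [] = []
psiGo n m' s cov (l ∷ ls) =
  let h = firstFree n s cov in
  (h , l) ∷ psiGo n m' s (blockElems n m' (h , l) ++ cov) ls

psi : (n m' : ℕ) → .{{NonZero n}} → List Block → ℕ → List Block
psi n m' π s = psiGo n m' s [] (lengthsFrom n π s)

-- π is an m-AP-partition of ℤ_n: every block has a head in ℤ_n and length ≥ 1,
-- and the concatenation of the element sequences of all blocks is a
-- permutation of 0,…,n-1 (so within each block the i elements are distinct,
-- the blocks are disjoint, and they cover ℤ_n).
IsAPPartition : (n m : ℕ) → .{{NonZero n}} → List Block → Set
IsAPPartition n m π =
  All (λ b → (proj₁ b < n) × (1 ≤ proj₂ b)) π × (allElems n m π ↭ upTo n)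

-- A type T = 1^{k₁} i₂^{k₂} ⋯ i_r^{k_r} is given by k₁ and the list
-- ts = ((i₂ , k₂) ∷ … ∷ (i_r , k_r) ∷ []).
ValidType : ℕ → List (ℕ × ℕ) → Set
ValidType k₁ ts =
  (ts ≢ [])                                            -- r ≥ 2
  × (1 ≤ k₁)
  × All (λ p → (1 < proj₁ p) × (1 ≤ proj₂ p)) ts
  × Linked (λ p q → proj₁ p < proj₁ q) ts

typeSize : ℕ → List (ℕ × ℕ) → ℕ
typeSize k₁ ts = k₁ + foldr (λ p acc → proj₂ p * proj₁ p + acc) 0 ts

nonSingCount : List (ℕ × ℕ) → ℕ
nonSingCount ts = foldr (λ p acc → proj₂ p + acc) 0 ts

HasType : List Block → ℕ → List (ℕ × ℕ) → Set
HasType π k₁ ts =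
  (countLen 1 π ≡ k₁)
  × All (λ p → countLen (proj₁ p) π ≡ proj₂ p) ts
  × All (λ b → (proj₂ b ≡ 1) ⊎ (proj₂ b ∈ map proj₁ ts)) π

IsHead : List Block → ℕ → Set
IsHead π h = Any (λ b → proj₁ b ≡ h) π

IsStart : (n : ℕ) → .{{NonZero n}} → List Block → ℕ → Set
IsStart n π h = IsHead π h × (∀ h' → IsHead π h' → g n π h' ≤ g n π h)

SameBlocks : List Block → List Block → Set
SameBlocks A B = ∀ b → (b ∈ A) ⇔ (b ∈ B)

module Submission where

-- Call t ∈ ℤ_n uncrossed when every block not headed at t lies
-- inside the arc t, t+1, …, t−1, and let L = i_r be the largest length.
--  (1) Pigeonhole.  Going once around ℤ_n, each singleton is counted by g at
--      exactly one non-singleton head, so k₁ = Σ_h g(h) ≤ K·g(t) for a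
--      starting point t, where K ≤ k₂ + ⋯ + k_r; hence by the hypothesis
--      (max{m, m'} − 1)(L − 1) ≤ ⌈k₁/K⌉ ≤ g(t).
--  (2) No crossing.  If a block (h, l), h ≠ t, passed over t, its span of
--      (l − 1)m + 1 places would contain t and the g(t) singletons before t,
--      but only (l − 1)(m − 1) ≤ (L − 1)(m − 1) ≤ g(t) places outside the
--      block.  So every starting point is uncrossed.
--  (3) Arcs.  For uncrossed s ≠ s' the lengths listed from s are A ++ B, A for
--      the arc from s to s' and B for the arc from s' to s, and from s' they
--      are B ++ A.  The blocks of each arc fill it exactly, and each list ends
--      with g(s') resp. g(s) ≥ (L − 1)(m' − 1) singletons (or has only 1's).
--  (4) Greedy filling.  A list of lengths ≤ L followed by at least
--      (L − 1)(m' − 1) singletons is placed by the greedy construction of ψ exactly inside its arc, so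
--      ψ from s is X ++ Y and ψ from s' is Y ++ X for the same X and Y.

open import Defs
open import Data.Bool using (true)
open import Data.Nat using (ℕ; _<_; _≤_; _∸_; _*_; _⊔_; NonZero)
open import Data.Nat.Properties using (m≤m⊔n; m≤n⊔m)
open import Data.List using (List)
open import Data.List.Relation.Unary.All using (All)
open import Data.Product using (Σ; _×_; proj₁; proj₂)
open import Relation.Binary.PropositionalEquality using (_≡_)

module Sums where

  open import Data.Bool using (Bool; true; false)
  open import Data.Nat
  open import Data.Nat.Properties
  open import Data.List using (List; []; _∷_; _++_; map; applyUpTo; filterᵇ; length; replicate)
  open import Data.List.Properties using (++-assoc)
  open import Data.List.Relation.Unary.All.Properties using (++⁺)
  open import Data.List.Relation.Binary.Permutation.Propositional as Perm using (_↭_)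
  open import Data.List.Relation.Unary.All using (All; []; _∷_)
  open import Data.List.Membership.Propositional using (_∈_)
  open import Data.List.Relation.Unary.Any using (here; there)
  open import Data.Product using (_×_; _,_)
  open import Data.Empty using (⊥-elim)
  open import Relation.Binary.PropositionalEquality using (_≡_; _≢_; refl; sym; trans; cong; cong₂; subst)
  open import Algebra.Properties.CommutativeSemigroup +-commutativeSemigroup using (interchange)
  open import Function using (_∘_)

  ind : Bool → ℕ
  ind true = 1
  ind false = 0

  ind≤1 : ∀ b → ind b ≤ 1
  ind≤1 true = s≤s z≤n
  ind≤1 false = z≤n

  sumTo : (ℕ → ℕ) → ℕ → ℕ
  sumTo f zero = 0
  sumTo f (suc N) = f 0 + sumTo (f ∘ suc) N

  sumTo-cong : ∀ {f g} N → (∀ k → k < N → f k ≡ g k) → sumTo f N ≡ sumTo g N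
  sumTo-cong zero eq = refl
  sumTo-cong (suc N) eq = cong₂ _+_ (eq 0 z<s) (sumTo-cong N (λ k k<N → eq (suc k) (s<s k<N)))

  sumTo-mono : ∀ {f g} N → (∀ k → k < N → f k ≤ g k) → sumTo f N ≤ sumTo g N
  sumTo-mono zero le = z≤n
  sumTo-mono (suc N) le = +-mono-≤ (le 0 z<s) (sumTo-mono N (λ k k<N → le (suc k) (s<s k<N)))

  sumTo-split : ∀ f a b → sumTo f (a + b) ≡ sumTo f a + sumTo (λ k → f (a + k)) b
  sumTo-split f zero b = refl
  sumTo-split f (suc a) b = trans (cong (f 0 +_) (sumTo-split (f ∘ suc) a b)) (sym (+-assoc (f 0) _ _))

  sumTo-snoc : ∀ f N → sumTo f (suc N) ≡ sumTo f N + f N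
  sumTo-snoc f zero = +-comm (f 0) 0
  sumTo-snoc f (suc N) = trans (cong (f 0 +_) (sumTo-snoc (f ∘ suc) N)) (sym (+-assoc (f 0) _ _))

  sumTo-+ : ∀ f g N → sumTo (λ k → f k + g k) N ≡ sumTo f N + sumTo g N
  sumTo-+ f g zero = refl
  sumTo-+ f g (suc N) =
    trans (cong (f 0 + g 0 +_) (sumTo-+ (f ∘ suc) (g ∘ suc) N)) (interchange (f 0) (g 0) _ _)

  sumTo-* : ∀ f c N → sumTo (λ k → f k * c) N ≡ sumTo f N * c
  sumTo-* f c zero = refl
  sumTo-* f c (suc N) = trans (cong (f 0 * c +_) (sumTo-* (f ∘ suc) c N)) (sym (*-distribʳ-+ c (f 0) _))

  sumTo-const : ∀ c N → sumTo (λ _ → c) N ≡ N * c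
  sumTo-const c zero = refl
  sumTo-const c (suc N) = cong (c +_) (sumTo-const c N)

  sumTo-zero : ∀ {f} N → (∀ k → k < N → f k ≡ 0) → sumTo f N ≡ 0
  sumTo-zero N eq = trans (sumTo-cong N eq) (trans (sumTo-const 0 N) (*-zeroʳ N))

  sumTo-ones : ∀ {f} N → (∀ k → k < N → f k ≡ 1) → sumTo f N ≡ N
  sumTo-ones N eq = trans (sumTo-cong N eq) (trans (sumTo-const 1 N) (*-identityʳ N))

  sumTo-≤ : ∀ {f} N → (∀ k → k < N → f k ≤ 1) → sumTo f N ≤ N
  sumTo-≤ {f} N le = subst (sumTo f N ≤_) (trans (sumTo-const 1 N) (*-identityʳ N)) (sumTo-mono N le)

  sumTo-full : ∀ {f} N → (∀ k → k < N → f k ≤ 1) → sumTo f N ≡ N → ∀ k → k < N → f k ≡ 1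
  sumTo-full {f} (suc N) le eq k k<sN = go k k<sN (split (f 0) _ (le 0 z<s) (sumTo-≤ N le-rest) eq)
    where
    le-rest : ∀ k → k < N → f (suc k) ≤ 1
    le-rest k k<N = le (suc k) (s<s k<N)
    split : ∀ a r → a ≤ 1 → r ≤ N → a + r ≡ suc N → (a ≡ 1) × (r ≡ N)
    split zero r _ r≤N e = ⊥-elim (<-irrefl e (s≤s r≤N))
    split 1 r _ _ e = refl , suc-injective e
    split (suc (suc _)) _ (s≤s ()) _ _
    go : ∀ k → k < suc N → (f 0 ≡ 1) × (sumTo (f ∘ suc) N ≡ N) → f k ≡ 1
    go zero _ (e₀ , _) = e₀
    go (suc k) (s<s k<N) (_ , eᵣ) = sumTo-full N le-rest eᵣ k k<N

  sumTo-monoᴺ : ∀ f N d → sumTo f N ≤ sumTo f (N + d)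
  sumTo-monoᴺ f N d = subst (sumTo f N ≤_) (sym (sumTo-split f N d)) (m≤m+n _ _)

  sumTo-point : ∀ y N → y < N → sumTo (λ k → ind (k ≡ᵇ y)) N ≡ 1
  sumTo-point zero (suc N) _ = cong suc (sumTo-zero N (λ _ _ → refl))
  sumTo-point (suc y) (suc N) (s<s y<N) = sumTo-point y N y<N

  sumTo-point-out : ∀ y N → N ≤ y → sumTo (λ k → ind (k ≡ᵇ y)) N ≡ 0
  sumTo-point-out y zero _ = refl
  sumTo-point-out (suc y) (suc N) (s≤s N≤y) = sumTo-point-out y N N≤y

  sumTo-below : ∀ D N → D ≤ N → sumTo (λ k → ind (k <ᵇ D)) N ≡ D
  sumTo-below zero N _ = sumTo-zero N (λ _ _ → refl)
  sumTo-below (suc D) (suc N) (s≤s D≤N) = cong suc (sumTo-below D N D≤N)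

  sumTo-reverse : ∀ f N → sumTo (λ k → f (N ∸ suc k)) N ≡ sumTo f N
  sumTo-reverse f zero = refl
  sumTo-reverse f (suc N) = trans (cong (f N +_) (sumTo-reverse f N)) (trans (+-comm (f N) _) (sym (sumTo-snoc f N)))

  countBelow : (ℕ → Bool) → ℕ → ℕ
  countBelow P N = sumTo (ind ∘ P) N

  countBelow-beyond : ∀ P B d → (∀ x → P x ≡ true → x < B) → countBelow P (B + d) ≡ countBelow P B
  countBelow-beyond P B d below =
    trans (sumTo-split (ind ∘ P) B d) (trans (cong (countBelow P B +_) (sumTo-zero d vanish)) (+-identityʳ _))
    where
    vanish : ∀ k → k < d → ind (P (B + k)) ≡ 0
    vanish k _ with P (B + k) in e
    ... | true = ⊥-elim (<⇒≱ (below _ e) (m≤m+n B k))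
    ... | false = refl

  sumL : ∀ {A : Set} → (A → ℕ) → List A → ℕ
  sumL f [] = 0
  sumL f (x ∷ xs) = f x + sumL f xs

  countL : ∀ {A : Set} → (A → Bool) → List A → ℕ
  countL p = sumL (ind ∘ p)

  sumL-++ : ∀ {A : Set} (f : A → ℕ) xs ys → sumL f (xs ++ ys) ≡ sumL f xs + sumL f ys
  sumL-++ f [] ys = refl
  sumL-++ f (x ∷ xs) ys = trans (cong (f x +_) (sumL-++ f xs ys)) (sym (+-assoc (f x) _ _))

  sumL-↭ : ∀ {A : Set} (f : A → ℕ) {xs ys} → xs ↭ ys → sumL f xs ≡ sumL f ys
  sumL-↭ f Perm.refl = refl
  sumL-↭ f (Perm.prep x p) = cong (f x +_) (sumL-↭ f p)
  sumL-↭ f (Perm.swap x y p) =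
    trans (sym (+-assoc (f x) (f y) _))
      (trans (cong₂ _+_ (+-comm (f x) (f y)) (sumL-↭ f p)) (+-assoc (f y) (f x) _))
  sumL-↭ f (Perm.trans p q) = trans (sumL-↭ f p) (sumL-↭ f q)

  sumL-map : ∀ {A B : Set} (f : B → ℕ) (g : A → B) xs → sumL f (map g xs) ≡ sumL (f ∘ g) xs
  sumL-map f g [] = refl
  sumL-map f g (x ∷ xs) = cong (f (g x) +_) (sumL-map f g xs)

  sumL-applyUpTo : ∀ {A : Set} (f : A → ℕ) (h : ℕ → A) N → sumL f (applyUpTo h N) ≡ sumTo (f ∘ h) N
  sumL-applyUpTo f h zero = refl
  sumL-applyUpTo f h (suc N) = cong (f (h 0) +_) (sumL-applyUpTo f (h ∘ suc) N)

  length-filterᵇ : ∀ {A : Set} (p : A → Bool) xs → length (filterᵇ p xs) ≡ countL p xs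
  length-filterᵇ p [] = refl
  length-filterᵇ p (x ∷ xs) with p x
  ... | true = cong suc (length-filterᵇ p xs)
  ... | false = length-filterᵇ p xs

  sumL-+ : ∀ {A : Set} (f g : A → ℕ) xs → sumL (λ x → f x + g x) xs ≡ sumL f xs + sumL g xs
  sumL-+ f g [] = refl
  sumL-+ f g (x ∷ xs) = trans (cong (f x + g x +_) (sumL-+ f g xs)) (interchange (f x) (g x) _ _)

  sumL-zero : ∀ {A : Set} (xs : List A) → sumL (λ _ → 0) xs ≡ 0
  sumL-zero [] = refl
  sumL-zero (x ∷ xs) = sumL-zero xs

  sumL-swap : ∀ {A B : Set} (F : A → B → ℕ) xs ys →
              sumL (λ x → sumL (F x) ys) xs ≡ sumL (λ y → sumL (λ x → F x y) xs) ys
  sumL-swap F [] ys = sym (sumL-zero ys)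
  sumL-swap F (x ∷ xs) ys =
    trans (cong (sumL (F x) ys +_) (sumL-swap F xs ys)) (sym (sumL-+ (F x) (λ y → sumL (λ x → F x y) xs) ys))

  sumTo-sumL : ∀ {A : Set} (F : A → ℕ → ℕ) xs N →
               sumTo (λ k → sumL (λ b → F b k) xs) N ≡ sumL (λ b → sumTo (F b) N) xs
  sumTo-sumL F [] N = sumTo-zero N (λ _ _ → refl)
  sumTo-sumL F (x ∷ xs) N =
    trans (sumTo-+ (F x) (λ k → sumL (λ b → F b k) xs) N) (cong (sumTo (F x) N +_) (sumTo-sumL F xs N))

  sumL-congᴬ : ∀ {A : Set} {f g : A → ℕ} xs → All (λ x → f x ≡ g x) xs → sumL f xs ≡ sumL g xs
  sumL-congᴬ [] _ = refl
  sumL-congᴬ (x ∷ xs) (e ∷ es) = cong₂ _+_ e (sumL-congᴬ xs es)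

  sumL-monoᴬ : ∀ {A : Set} {f g : A → ℕ} xs → All (λ x → f x ≤ g x) xs → sumL f xs ≤ sumL g xs
  sumL-monoᴬ [] _ = z≤n
  sumL-monoᴬ (x ∷ xs) (le ∷ les) = +-mono-≤ le (sumL-monoᴬ xs les)

  sumL-∈ : ∀ {A : Set} (f : A → ℕ) {xs x} → x ∈ xs → f x ≤ sumL f xs
  sumL-∈ f {x ∷ xs} (here refl) = m≤m+n (f x) _
  sumL-∈ f {x ∷ xs} (there p) = ≤-trans (sumL-∈ f p) (m≤n+m _ (f x))

  sumL-∈₂ : ∀ {A : Set} (f : A → ℕ) {xs x y} → x ∈ xs → y ∈ xs → x ≢ y → f x + f y ≤ sumL f xs
  sumL-∈₂ f (here refl) (here refl) ne = ⊥-elim (ne refl)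
  sumL-∈₂ f {z ∷ _} (here refl) (there q) ne = +-monoʳ-≤ (f z) (sumL-∈ f q)
  sumL-∈₂ f {z ∷ zs} {x} {y} (there p) (here refl) ne =
    subst (_≤ f z + sumL f zs) (+-comm (f y) (f x)) (+-monoʳ-≤ (f z) (sumL-∈ f p))
  sumL-∈₂ f {z ∷ _} (there p) (there q) ne = ≤-trans (sumL-∈₂ f p q ne) (m≤n+m _ (f z))

  concatTo : ∀ {A : Set} → (ℕ → List A) → ℕ → List A
  concatTo f zero = []
  concatTo f (suc N) = f 0 ++ concatTo (f ∘ suc) N

  concatTo-split : ∀ {A : Set} (f : ℕ → List A) a b → concatTo f (a + b) ≡ concatTo f a ++ concatTo (λ k → f (a + k)) b
  concatTo-split f zero b = refl
  concatTo-split f (suc a) b = trans (cong (f 0 ++_) (concatTo-split (f ∘ suc) a b)) (sym (++-assoc (f 0) _ _))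

  concatTo-cong : ∀ {A : Set} {f g : ℕ → List A} N → (∀ k → k < N → f k ≡ g k) → concatTo f N ≡ concatTo g N
  concatTo-cong zero eq = refl
  concatTo-cong (suc N) eq = cong₂ _++_ (eq 0 z<s) (concatTo-cong N (λ k k<N → eq (suc k) (s<s k<N)))

  sumL-concatTo : ∀ {A : Set} (w : A → ℕ) f N → sumL w (concatTo f N) ≡ sumTo (λ k → sumL w (f k)) N
  sumL-concatTo w f zero = refl
  sumL-concatTo w f (suc N) = trans (sumL-++ w (f 0) _) (cong (sumL w (f 0) +_) (sumL-concatTo w (f ∘ suc) N))

  All-concatTo : ∀ {A : Set} {Q : A → Set} f N → (∀ k → k < N → All Q (f k)) → All Q (concatTo f N)
  All-concatTo f zero _ = []
  All-concatTo f (suc N) all = ++⁺ (all 0 z<s) (All-concatTo (f ∘ suc) N (λ k k<N → all (suc k) (s<s k<N)))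

  concatTo-ones : ∀ (q : ℕ → Bool) N → concatTo (λ k → replicate (ind (q k)) 1) N ≡ replicate (countBelow q N) 1
  concatTo-ones q zero = refl
  concatTo-ones q (suc N) with q 0
  ... | true = cong (1 ∷_) (concatTo-ones (q ∘ suc) N)
  ... | false = concatTo-ones (q ∘ suc) N

module Bools where

  open import Data.Bool using (Bool; true; false; _∧_; _∨_; not)
  open import Data.Nat
  open import Data.Nat.Properties
  open import Data.List using ([]; _∷_; _++_; map; applyUpTo)
  open import Data.Bool.ListAction using (any)
  open import Data.List.Relation.Unary.All using (All; []; _∷_)
  open import Data.List.Membership.Propositional using (_∈_)
  open import Data.List.Relation.Unary.Any using (here; there)
  open import Data.Product using (Σ; _×_; _,_)
  open import Data.Sum using (_⊎_; inj₁; inj₂)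
  open import Data.Empty using (⊥; ⊥-elim)
  open import Relation.Binary.PropositionalEquality using (_≡_; _≢_; refl; trans; cong; cong₂)
  open import Function using (_∘_)
  open import Defs using (findFirst; elemᵇ)
  open Sums

  true≢false : ∀ {b} → b ≡ true → b ≡ false → ⊥
  true≢false refl ()

  not-true : ∀ {b} → not b ≡ true → b ≡ false
  not-true {false} _ = refl

  not-false : ∀ {b} → not b ≡ false → b ≡ true
  not-false {true} _ = refl

  ∨-true : ∀ a b → (a ∨ b) ≡ true → (a ≡ true) ⊎ (b ≡ true)
  ∨-true true b _ = inj₁ refl
  ∨-true false b e = inj₂ e

  ∨-introˡ : ∀ {a} b → a ≡ true → (a ∨ b) ≡ true
  ∨-introˡ b refl = refl

  ∨-introʳ : ∀ a {b} → b ≡ true → (a ∨ b) ≡ true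
  ∨-introʳ true _ = refl
  ∨-introʳ false e = e

  ∧-true : ∀ {a b} → (a ∧ b) ≡ true → (a ≡ true) × (b ≡ true)
  ∧-true {true} {true} _ = refl , refl

  ind-∨ : ∀ a b → (a ∧ b) ≡ false → ind (a ∨ b) ≡ ind a + ind b
  ind-∨ true false _ = refl
  ind-∨ false b _ = refl

  ≡ᵇ-refl : ∀ x → (x ≡ᵇ x) ≡ true
  ≡ᵇ-refl zero = refl
  ≡ᵇ-refl (suc x) = ≡ᵇ-refl x

  ≡ᵇ-true : ∀ {x y} → x ≡ y → (x ≡ᵇ y) ≡ true
  ≡ᵇ-true {x} refl = ≡ᵇ-refl x

  ≡ᵇ-sound : ∀ x y → (x ≡ᵇ y) ≡ true → x ≡ y
  ≡ᵇ-sound zero zero _ = refl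
  ≡ᵇ-sound (suc x) (suc y) e = cong suc (≡ᵇ-sound x y e)

  ≡ᵇ-false : ∀ {x y} → x ≢ y → (x ≡ᵇ y) ≡ false
  ≡ᵇ-false {x} {y} ne with x ≡ᵇ y in e
  ... | true = ⊥-elim (ne (≡ᵇ-sound x y e))
  ... | false = refl

  ≡ᵇ-sym : ∀ x y → (x ≡ᵇ y) ≡ (y ≡ᵇ x)
  ≡ᵇ-sym zero zero = refl
  ≡ᵇ-sym zero (suc y) = refl
  ≡ᵇ-sym (suc x) zero = refl
  ≡ᵇ-sym (suc x) (suc y) = ≡ᵇ-sym x y

  <ᵇ-true : ∀ {x y} → x < y → (x <ᵇ y) ≡ true
  <ᵇ-true {zero} (s≤s _) = refl
  <ᵇ-true {suc x} (s≤s (s≤s p)) = <ᵇ-true (s≤s p)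

  <ᵇ-false : ∀ {x y} → y ≤ x → (x <ᵇ y) ≡ false
  <ᵇ-false {x} {zero} _ = refl
  <ᵇ-false {suc x} {suc y} (s≤s p) = <ᵇ-false p

  <ᵇ-sound : ∀ x y → (x <ᵇ y) ≡ true → x < y
  <ᵇ-sound zero (suc y) _ = s≤s z≤n
  <ᵇ-sound (suc x) (suc y) e = s≤s (<ᵇ-sound x y e)

  <ᵇ-sound-false : ∀ x y → (x <ᵇ y) ≡ false → y ≤ x
  <ᵇ-sound-false x zero _ = z≤n
  <ᵇ-sound-false (suc x) (suc y) e = s≤s (<ᵇ-sound-false x y e)

  +-≡ᵇ : ∀ a e k → (a + e ≡ᵇ k) ≡ (not (k <ᵇ a) ∧ (e ≡ᵇ (k ∸ a)))
  +-≡ᵇ zero e k = refl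
  +-≡ᵇ (suc a) e zero = refl
  +-≡ᵇ (suc a) e (suc k) = +-≡ᵇ a e k

  <ᵇ-split : ∀ a c k → ((k <ᵇ a) ∨ ((k ∸ a) <ᵇ c)) ≡ (k <ᵇ (a + c))
  <ᵇ-split zero c k = refl
  <ᵇ-split (suc a) c zero = refl
  <ᵇ-split (suc a) c (suc k) = <ᵇ-split a c k

  any-++ : ∀ {A : Set} (q : A → Bool) xs ys → any q (xs ++ ys) ≡ (any q xs ∨ any q ys)
  any-++ q [] ys = refl
  any-++ q (x ∷ xs) ys with q x
  ... | true = refl
  ... | false = any-++ q xs ys

  any-map : ∀ {A B : Set} (q : B → Bool) (g : A → B) xs → any q (map g xs) ≡ any (q ∘ g) xs
  any-map q g [] = refl
  any-map q g (x ∷ xs) = cong (q (g x) ∨_) (any-map q g xs)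

  any-∧ : ∀ {A : Set} c (q : A → Bool) xs → any (λ x → c ∧ q x) xs ≡ (c ∧ any q xs)
  any-∧ true q xs = refl
  any-∧ false q [] = refl
  any-∧ false q (x ∷ xs) = any-∧ false q xs

  any-sound : ∀ {A : Set} (q : A → Bool) xs → any q xs ≡ true → Σ A λ x → x ∈ xs × q x ≡ true
  any-sound q (x ∷ xs) e with q x in eq
  ... | true = x , here refl , eq
  ... | false with any-sound q xs e
  ... | y , y∈ , qy = y , there y∈ , qy

  any-intro : ∀ {A : Set} (q : A → Bool) {xs x} → x ∈ xs → q x ≡ true → any q xs ≡ true
  any-intro q {x ∷ xs} (here refl) e rewrite e = refl
  any-intro q {x ∷ xs} (there p) e with q x
  ... | true = refl
  ... | false = any-intro q p e

  any-false : ∀ {A : Set} (q : A → Bool) xs → any q xs ≡ false → All (λ x → q x ≡ false) xs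
  any-false q [] _ = []
  any-false q (x ∷ xs) e with q x in eq
  ... | false = eq ∷ any-false q xs e

  applyUpTo-any : ∀ {A : Set} (q : A → Bool) (h : ℕ → A) N →
                  any q (applyUpTo h N) ≡ true → Σ ℕ λ j → j < N × q (h j) ≡ true
  applyUpTo-any q h (suc N) e with q (h 0) in eq
  ... | true = 0 , z<s , eq
  ... | false with applyUpTo-any q (h ∘ suc) N e
  ... | j , j<N , qj = suc j , s<s j<N , qj

  applyUpTo-any-intro : ∀ {A : Set} (q : A → Bool) (h : ℕ → A) N j →
                        j < N → q (h j) ≡ true → any q (applyUpTo h N) ≡ true
  applyUpTo-any-intro q h (suc N) zero _ e rewrite e = refl
  applyUpTo-any-intro q h (suc N) (suc j) (s<s j<N) e with q (h 0)
  ... | true = refl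
  ... | false = applyUpTo-any-intro q (h ∘ suc) N j j<N e

  applyUpTo-any-cong : ∀ {A B : Set} (q : A → Bool) (h : ℕ → A) (q' : B → Bool) (h' : ℕ → B) N →
    (∀ j → j < N → q (h j) ≡ q' (h' j)) → any q (applyUpTo h N) ≡ any q' (applyUpTo h' N)
  applyUpTo-any-cong q h q' h' zero _ = refl
  applyUpTo-any-cong q h q' h' (suc N) e =
    cong₂ _∨_ (e 0 z<s) (applyUpTo-any-cong q (h ∘ suc) q' (h' ∘ suc) N (λ j j<N → e (suc j) (s<s j<N)))

  countBelow-∨ : ∀ P Q N → (∀ x → (P x ∧ Q x) ≡ false) →
                 countBelow (λ x → P x ∨ Q x) N ≡ countBelow P N + countBelow Q N
  countBelow-∨ P Q N disjoint =
    trans (sumTo-cong N (λ k _ → ind-∨ (P k) (Q k) (disjoint k))) (sumTo-+ (ind ∘ P) (ind ∘ Q) N)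

  elemᵇ-++ : ∀ x xs ys → elemᵇ x (xs ++ ys) ≡ (elemᵇ x xs ∨ elemᵇ x ys)
  elemᵇ-++ x xs ys = any-++ (λ y → y ≡ᵇ x) xs ys

  countL-any : ∀ {A : Set} (q : A → Bool) xs → any q xs ≡ true → 1 ≤ countL q xs
  countL-any q (x ∷ xs) e with q x
  ... | true = s≤s z≤n
  ... | false = countL-any q xs e

  any-countL : ∀ {A : Set} (q : A → Bool) xs → 1 ≤ countL q xs → any q xs ≡ true
  any-countL q (x ∷ xs) le with q x
  ... | true = refl
  ... | false = any-countL q xs le

  countL≤1 : ∀ {A : Set} (q : A → Bool) xs → countL q xs ≤ 1 → countL q xs ≡ ind (any q xs)
  countL≤1 q [] _ = refl
  countL≤1 q (x ∷ xs) le with q x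
  ... | true = cong suc (n≤0⇒n≡0 (≤-pred le))
  ... | false = countL≤1 q xs le

  findFirst-at : ∀ (q : ℕ → Bool) (h : ℕ → ℕ) d N r → r < N → q (h r) ≡ true →
                 (∀ j → j < r → q (h j) ≡ false) → findFirst q (applyUpTo h N) d ≡ h r
  findFirst-at q h d (suc N) zero r<N e _ rewrite e = refl
  findFirst-at q h d (suc N) (suc r) (s<s r<N) e earlier rewrite earlier 0 z<s =
    findFirst-at q (h ∘ suc) d N r r<N e (λ j j<r → earlier (suc j) (s<s j<r))

  findFirst-spec : ∀ (q : ℕ → Bool) (h : ℕ → ℕ) d N →
     (findFirst q (applyUpTo h N) d ≡ d × (∀ j → j < N → q (h j) ≡ false))
     ⊎ (Σ ℕ λ r → r < N × q (h r) ≡ true × (∀ j → j < r → q (h j) ≡ false)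
                  × findFirst q (applyUpTo h N) d ≡ h r)
  findFirst-spec q h d zero = inj₁ (refl , λ j ())
  findFirst-spec q h d (suc N) with q (h 0) in e
  ... | true = inj₂ (0 , z<s , e , (λ j ()) , refl)
  ... | false with findFirst-spec q (h ∘ suc) d N
  ... | inj₁ (res , none) = inj₁ (res , λ { zero _ → e ; (suc j) (s<s j<N) → none j j<N })
  ... | inj₂ (r , r<N , qr , earlier , res) =
        inj₂ (suc r , s<s r<N , qr , (λ { zero _ → e ; (suc j) (s<s j<r) → earlier j j<r }) , res)

-- Arithmetic in ℤ_n with elements 0, …, n − 1.  dist t y = (y − t) mod n is
-- the clockwise distance from t to y; it identifies ℤ_n with the linear order
-- t < t+1 < ⋯ < t−1 used by the separation algorithm.
module Cyclic (n : ℕ) .{{_ : NonZero n}} where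

  open import Data.Nat
  open import Data.Nat.Properties
  open import Data.Nat.DivMod
  open import Relation.Binary.PropositionalEquality using (_≡_; _≢_; refl; sym; trans; cong; cong₂; subst)
  open import Relation.Nullary using (yes; no)
  open import Data.Empty using (⊥-elim)
  open import Defs using (minusMod)
  open Sums
  open Bools

  %-+ˡ : ∀ a b → ((a % n) + b) % n ≡ (a + b) % n
  %-+ˡ a b = trans (%-distribˡ-+ (a % n) b n)
               (trans (cong (λ z → (z + b % n) % n) (m%n%n≡m%n a n)) (sym (%-distribˡ-+ a b n)))

  %-+ʳ : ∀ a b → (a + (b % n)) % n ≡ (a + b) % n
  %-+ʳ a b = trans (cong (_% n) (+-comm a (b % n))) (trans (%-+ˡ b a) (cong (_% n) (+-comm b a)))

  shift-+ : ∀ t k j → ((t + k) % n + j) % n ≡ (t + (k + j)) % n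
  shift-+ t k j = trans (%-+ˡ (t + k) j) (cong (_% n) (+-assoc t k j))

  dist : ℕ → ℕ → ℕ
  dist t y = (y + (n ∸ t)) % n

  dist<n : ∀ t y → dist t y < n
  dist<n t y = m%n<n (y + (n ∸ t)) n

  private
    t+[y+[n∸t]] : ∀ {t} → t < n → ∀ y → t + (y + (n ∸ t)) ≡ y + n
    t+[y+[n∸t]] {t} t<n y =
      trans (sym (+-assoc t y (n ∸ t)))
        (trans (cong (_+ (n ∸ t)) (+-comm t y)) (trans (+-assoc y t (n ∸ t)) (cong (y +_) (m+[n∸m]≡n (<⇒≤ t<n)))))

  +-dist : ∀ {t y} → t < n → y < n → (t + dist t y) % n ≡ y
  +-dist {t} {y} t<n y<n =
    trans (%-+ʳ t (y + (n ∸ t)))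
      (trans (cong (_% n) (t+[y+[n∸t]] t<n y)) (trans ([m+n]%n≡m%n y n) (m<n⇒m%n≡m y<n)))

  dist-+ : ∀ {t k} → t < n → k < n → dist t ((t + k) % n) ≡ k
  dist-+ {t} {k} t<n k<n =
    trans (%-+ˡ (t + k) (n ∸ t))
      (trans (cong (_% n) (trans (+-assoc t k (n ∸ t)) (t+[y+[n∸t]] t<n k)))
        (trans ([m+n]%n≡m%n k n) (m<n⇒m%n≡m k<n)))

  +-%-injective : ∀ {o u k} → o < n → u < n → k < n → (o + u) % n ≡ (o + k) % n → u ≡ k
  +-%-injective {o} o<n u<n k<n e = trans (sym (dist-+ o<n u<n)) (trans (cong (dist o) e) (dist-+ o<n k<n))

  +-%-≡ᵇ : ∀ {o u k} → o < n → u < n → k < n → ((o + u) % n ≡ᵇ (o + k) % n) ≡ (u ≡ᵇ k)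
  +-%-≡ᵇ {o} {u} {k} o<n u<n k<n with u ≟ k
  ... | yes refl = trans (≡ᵇ-refl ((o + u) % n)) (sym (≡ᵇ-refl u))
  ... | no u≢k = trans (≡ᵇ-false (λ e → u≢k (+-%-injective o<n u<n k<n e))) (sym (≡ᵇ-false u≢k))

  dist-self : ∀ t → t < n → dist t t ≡ 0
  dist-self t t<n = trans (cong (_% n) (trans (+-comm t (n ∸ t)) (m∸n+n≡m (<⇒≤ t<n)))) (n%n≡0 n)

  dist≡0 : ∀ {t y} → t < n → y < n → dist t y ≡ 0 → y ≡ t
  dist≡0 {t} {y} t<n y<n e =
    trans (sym (+-dist t<n y<n)) (trans (cong (λ z → (t + z) % n) e) (trans (cong (_% n) (+-identityʳ t)) (m<n⇒m%n≡m t<n)))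

  minusMod-∸ : ∀ t {o} → o ≤ n → minusMod n t (n ∸ o) ≡ (t + o) % n
  minusMod-∸ t o≤n = cong (λ z → (t + z) % n) (m∸[m∸n]≡n o≤n)

  +≡minusMod : ∀ x len k → len ≤ n → k ≤ len → (x + k) % n ≡ minusMod n ((x + len) % n) (len ∸ k)
  +≡minusMod x len k len≤n k≤len =
    sym (trans (shift-+ x len (n ∸ (len ∸ k)))
          (trans (cong (λ z → (x + z) % n) len+[n∸j])
            (trans (cong (_% n) (sym (+-assoc x k n))) ([m+n]%n≡m%n (x + k) n))))
    where
    len+[n∸j] : len + (n ∸ (len ∸ k)) ≡ k + n
    len+[n∸j] = trans (cong (_+ (n ∸ (len ∸ k))) (trans (sym (m∸n+n≡m k≤len)) (+-comm (len ∸ k) k)))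
                  (trans (+-assoc k (len ∸ k) _) (cong (k +_) (m+[n∸m]≡n (≤-trans (m∸n≤m len k) len≤n))))

  minusMod≡+ : ∀ z K j → K ≤ n → j ≤ K → minusMod n ((z + K) % n) j ≡ (z + (K ∸ j)) % n
  minusMod≡+ z K j K≤n j≤K =
    trans (cong (minusMod n ((z + K) % n)) (sym (m∸[m∸n]≡n j≤K))) (sym (+≡minusMod z K (K ∸ j) K≤n (m∸n≤m K j)))

  sumTo-rotate : ∀ f x → x < n → sumTo f n ≡ sumTo (λ k → f ((x + k) % n)) n
  sumTo-rotate f x x<n =
    trans (cong (sumTo f) (sym x+E≡n))
    (trans (sumTo-split f x E)
    (trans (+-comm (sumTo f x) _)
    (trans (cong₂ _+_ (sumTo-cong E (λ k k<E → cong f (sym (m<n⇒m%n≡m (subst (x + k <_) x+E≡n (+-monoʳ-< x k<E))))))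
                      (sumTo-cong x (λ k k<x → cong f (sym (wrapped k k<x)))))
    (trans (sym (sumTo-split (λ k → f ((x + k) % n)) E x)) (cong (sumTo (λ k → f ((x + k) % n))) (trans (+-comm E x) x+E≡n))))))
    where
    E = n ∸ x
    x+E≡n : x + E ≡ n
    x+E≡n = m+[n∸m]≡n (<⇒≤ x<n)
    wrapped : ∀ k → k < x → (x + (E + k)) % n ≡ k
    wrapped k k<x = trans (cong (_% n) (trans (sym (+-assoc x E k)) (trans (cong (_+ k) x+E≡n) (+-comm n k))))
                      (trans ([m+n]%n≡m%n k n) (m<n⇒m%n≡m (<-trans k<x x<n)))

  count-arc : ∀ x h len → x < n → h < n → len ≤ n →
              countBelow (λ k → h ≡ᵇ (x + k) % n) len ≡ ind (dist x h <ᵇ len)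
  count-arc x h len x<n h<n len≤n =
    trans (sumTo-cong len (λ k k<len → cong ind
             (trans (cong (_≡ᵇ (x + k) % n) (sym (+-dist x<n h<n)))
               (trans (+-%-≡ᵇ x<n (dist<n x h) (<-≤-trans k<len len≤n)) (≡ᵇ-sym (dist x h) k)))))
    (by-cases (dist x h <? len))
    where
    by-cases : _ → sumTo (λ k → ind (k ≡ᵇ dist x h)) len ≡ ind (dist x h <ᵇ len)
    by-cases (yes inside) = trans (sumTo-point (dist x h) len inside) (sym (cong ind (<ᵇ-true inside)))
    by-cases (no outside) = trans (sumTo-point-out (dist x h) len (≮⇒≥ outside)) (sym (cong ind (<ᵇ-false (≮⇒≥ outside))))

  dist-turn : ∀ {x y} → x < n → y < n → x ≢ y → dist x y + dist y x ≡ n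
  dist-turn {x} {y} x<n y<n x≢y = trans (cong (dist x y +_) y→x) (m+[n∸m]≡n (<⇒≤ (dist<n x y)))
    where
    D = dist x y
    D≥1 : 1 ≤ D
    D≥1 with D in eq
    ... | zero = ⊥-elim (x≢y (sym (dist≡0 x<n y<n eq)))
    ... | suc _ = s≤s z≤n
    back-at-x : (y + (n ∸ D)) % n ≡ x
    back-at-x = trans (cong (λ w → (w + (n ∸ D)) % n) (sym (+-dist x<n y<n)))
                  (trans (shift-+ x D (n ∸ D)) (trans (cong (λ w → (x + w) % n) (m+[n∸m]≡n (<⇒≤ (dist<n x y))))
                    (trans ([m+n]%n≡m%n x n) (m<n⇒m%n≡m x<n))))
    y→x : dist y x ≡ n ∸ D
    y→x = trans (cong (dist y) (sym back-at-x)) (dist-+ y<n (∸-monoʳ-< {n} {D} {0} D≥1 (<⇒≤ (dist<n x y))))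

-- The greedy construction psiGo with step μ, analysed on a stretch of ℤ_n
-- that starts a positions after the origin o and is still completely free.
-- In linear coordinates relative to o + a the blocks placed so far cover a
-- set W of naturals.  The invariant Inv W c σ says that W consists of c
-- elements of [0, c + σ) and every element of W is either preceded only by
-- elements of W or lies μ after an element of W; the slack σ bounds the
-- holes.  A length list is Fine when the slack created by each block is
-- absorbed by the lengths still to come; then the list fills [0, Σ ls).
module Greedy (n : ℕ) .{{_ : NonZero n}} (μ : ℕ) (μ≥1 : 1 ≤ μ) where

  open import Data.Bool using (true; false; _∧_; _∨_; not)
  open import Data.Bool.Properties using (∨-identityʳ)
  open import Data.Nat
  open import Data.Nat.Properties
  open import Data.List using (List; []; _∷_; _++_; applyUpTo; upTo; replicate)
  open import Data.List.Properties using (map-upTo; applyUpTo-∷ʳ)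
  open import Data.List.Relation.Unary.All using (All; []; _∷_)
  open import Data.Unit using (⊤; tt)
  open import Data.Product using (Σ; _×_; _,_; proj₁; proj₂)
  open import Data.Sum using (_⊎_; inj₁; inj₂)
  open import Data.Empty using (⊥-elim)
  open import Relation.Binary.PropositionalEquality using (_≡_; refl; sym; trans; cong; cong₂; subst)
  open import Relation.Nullary using (yes; no)
  open import Defs
  open Sums
  open Bools
  open Cyclic n

  apRun : ℕ → ℕ → List ℕ
  apRun f l = applyUpTo (λ j → f + j * μ) l

  apRun-sound : ∀ f l x → elemᵇ x (apRun f l) ≡ true → Σ ℕ λ j → j < l × f + j * μ ≡ x
  apRun-sound f l x e with applyUpTo-any (λ y → y ≡ᵇ x) (λ j → f + j * μ) l e
  ... | j , j<l , q = j , j<l , ≡ᵇ-sound _ _ q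

  apRun-intro : ∀ f l j → j < l → elemᵇ (f + j * μ) (apRun f l) ≡ true
  apRun-intro f l j j<l =
    applyUpTo-any-intro (λ y → y ≡ᵇ (f + j * μ)) (λ j → f + j * μ) l j j<l (≡ᵇ-refl (f + j * μ))

  countBelow-apRun : ∀ f l N → (∀ j → j < l → f + j * μ < N) → countBelow (λ x → elemᵇ x (apRun f l)) N ≡ l
  countBelow-apRun f zero N _ = sumTo-zero N (λ _ _ → refl)
  countBelow-apRun f (suc l) N below =
    trans (sumTo-cong N (λ k _ → cong ind (trans (cong (elemᵇ k) (sym (applyUpTo-∷ʳ (λ j → f + j * μ) l)))
                                                 (elemᵇ-++ k (apRun f l) (e ∷ [])))))
    (trans (countBelow-∨ (λ x → elemᵇ x (apRun f l)) (λ x → (e ≡ᵇ x) ∨ false) N disjoint)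
    (trans (cong₂ _+_ (countBelow-apRun f l N (λ j j<l → below j (m<n⇒m<1+n j<l))) last) (+-comm l 1)))
    where
    e : ℕ
    e = f + l * μ
    earlier : ∀ x → elemᵇ x (apRun f l) ≡ true → x < e
    earlier x ex with apRun-sound f l x ex
    ... | j , j<l , refl = +-monoʳ-< f (*-monoˡ-< μ {{>-nonZero μ≥1}} j<l)
    disjoint : ∀ x → (elemᵇ x (apRun f l) ∧ ((e ≡ᵇ x) ∨ false)) ≡ false
    disjoint x with elemᵇ x (apRun f l) in ex
    ... | false = refl
    ... | true with e ≡ᵇ x in ee
    ... | true = ⊥-elim (<-irrefl (sym (≡ᵇ-sound e x ee)) (earlier x ex))
    ... | false = refl
    last : countBelow (λ x → (e ≡ᵇ x) ∨ false) N ≡ 1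
    last = trans (sumTo-cong N (λ k _ → cong ind (trans (∨-identityʳ _) (≡ᵇ-sym e k))))
                 (sumTo-point e N (below l (n<1+n l)))

  leastFree : List ℕ → ℕ
  leastFree W = findFirst (λ j → not (elemᵇ j W)) (upTo n) 0

  greedyLine : ℕ → List ℕ → List ℕ → List Block
  greedyLine p W [] = []
  greedyLine p W (l ∷ ls) = ((p + leastFree W) % n , l) ∷ greedyLine p (apRun (leastFree W) l ++ W) ls

  -- a block of length l placed with slack σ leaves slack at most slack σ l
  slack : ℕ → ℕ → ℕ
  slack σ l = (σ ∸ l) ⊔ ((l ∸ 1) * (μ ∸ 1))

  total : List ℕ → ℕ
  total = sumL (λ x → x)

  Fine : ℕ → List ℕ → Set
  Fine σ [] = ⊤
  Fine σ (l ∷ ls) = slack σ l ≤ total ls × Fine (slack σ l) ls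

  record Inv (W : List ℕ) (c σ : ℕ) : Set where
    field
      bounded : ∀ x → elemᵇ x W ≡ true → x < c + σ
      size : countBelow (λ x → elemᵇ x W) (c + σ) ≡ c
      supported : ∀ x → elemᵇ x W ≡ true →
                  (∀ y → y < x → elemᵇ y W ≡ true) ⊎ (μ ≤ x × elemᵇ (x ∸ μ) W ≡ true)

  open Inv

  Inv-empty : Inv [] 0 0
  Inv-empty = record { bounded = λ x () ; size = refl ; supported = λ x () }

  Inv-full : ∀ W c → Inv W c 0 → ∀ x → elemᵇ x W ≡ (x <ᵇ c)
  Inv-full W c I x with elemᵇ x W in e
  ... | true = sym (<ᵇ-true (subst (x <_) (+-identityʳ c) (bounded I x e)))
  ... | false with x <? c
  ... | no x≮c = sym (<ᵇ-false (≮⇒≥ x≮c))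
  ... | yes x<c = ⊥-elim (true≢false (ind≡1 (sumTo-full (c + 0) (λ k _ → ind≤1 (elemᵇ k W))
                           (trans (size I) (sym (+-identityʳ c))) x (subst (x <_) (sym (+-identityʳ c)) x<c))) e)
    where
    ind≡1 : ∀ {b} → ind b ≡ 1 → b ≡ true
    ind≡1 {true} _ = refl

  -- the least free place is at most c: W has only c elements
  leastFree-spec : ∀ W c σ → Inv W c σ → c < n → c + σ ≤ n →
    (elemᵇ (leastFree W) W ≡ false) × (∀ j → j < leastFree W → elemᵇ j W ≡ true) × leastFree W ≤ c
  leastFree-spec W c σ I c<n cσ≤n with findFirst-spec (λ j → not (elemᵇ j W)) (λ x → x) 0 n
  ... | inj₁ (_ , none) = ⊥-elim (<-irrefl refl (subst (c <_) cσ≡c (bounded I c (all-in c c<n))))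
    where
    all-in : ∀ j → j < n → elemᵇ j W ≡ true
    all-in j j<n = not-false (none j j<n)
    cσ≡c : c + σ ≡ c
    cσ≡c = trans (sym (sumTo-ones (c + σ) (λ k k< → cong ind (all-in k (≤-trans k< cσ≤n))))) (size I)
  ... | inj₂ (r , r<n , qr , earlier , eq) rewrite eq = not-true qr , (λ j j<r → not-false (earlier j j<r)) , r≤c
    where
    r≤cσ : r ≤ c + σ
    r≤cσ with r ≤? c + σ
    ... | yes r≤ = r≤
    ... | no r≰ = ⊥-elim (<-irrefl refl (bounded I (c + σ) (not-false (earlier (c + σ) (≰⇒> r≰)))))
    r≤c : r ≤ c
    r≤c = subst (_≤ c) (sumTo-ones r (λ k k<r → cong ind (not-false (earlier k k<r))))
            (subst (countBelow (λ x → elemᵇ x W) r ≤_)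
              (trans (cong (countBelow (λ x → elemᵇ x W)) (m+[n∸m]≡n r≤cσ)) (size I))
              (sumTo-monoᴺ (λ k → ind (elemᵇ k W)) r (c + σ ∸ r)))

  module Step (W : List ℕ) (c σ l : ℕ) (I : Inv W c σ) (f : ℕ)
              (f-free : elemᵇ f W ≡ false) (before-f : ∀ j → j < f → elemᵇ j W ≡ true) (f≤c : f ≤ c) where

    W' : List ℕ
    W' = apRun f l ++ W
    σ' : ℕ
    σ' = slack σ l

    within : ∀ j → j < l → f + j * μ < c + l + σ'
    within j (s≤s {n = l'} j≤l') = begin-strict
        f + j * μ                   ≤⟨ +-mono-≤ f≤c (*-monoˡ-≤ μ j≤l') ⟩
        c + l' * μ                  ≡⟨ cong (λ z → c + l' * z) μ≡1+[μ∸1] ⟩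
        c + l' * suc (μ ∸ 1)        ≡⟨ cong (c +_) (*-suc l' (μ ∸ 1)) ⟩
        c + (l' + l' * (μ ∸ 1))     <⟨ +-monoʳ-< c (s≤s ≤-refl) ⟩
        c + (suc l' + l' * (μ ∸ 1)) ≡⟨ sym (+-assoc c (suc l') _) ⟩
        c + suc l' + l' * (μ ∸ 1)   ≤⟨ +-monoʳ-≤ (c + suc l') (m≤n⊔m (σ ∸ suc l') (l' * (μ ∸ 1))) ⟩
        c + suc l' + σ'             ∎
      where
      open ≤-Reasoning
      μ≡1+[μ∸1] : μ ≡ suc (μ ∸ 1)
      μ≡1+[μ∸1] = trans (sym (m∸n+n≡m μ≥1)) (+-comm (μ ∸ 1) 1)

    old-within : c + σ ≤ c + l + σ'
    old-within = begin
        c + σ                ≤⟨ +-monoʳ-≤ c (m≤n+m∸n σ l) ⟩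
        c + (l + (σ ∸ l))    ≡⟨ sym (+-assoc c l _) ⟩
        c + l + (σ ∸ l)      ≤⟨ +-monoʳ-≤ (c + l) (m≤m⊔n (σ ∸ l) _) ⟩
        c + l + σ'           ∎
      where open ≤-Reasoning

    step-back : ∀ j → (f + (μ + j * μ)) ∸ μ ≡ f + j * μ
    step-back j = trans (cong (_∸ μ) (trans (sym (+-assoc f μ (j * μ)))
                    (trans (cong (_+ j * μ) (+-comm f μ)) (+-assoc μ f (j * μ))))) (m+n∸m≡n μ (f + j * μ))

    fresh : ∀ j → elemᵇ (f + j * μ) W ≡ false
    fresh zero rewrite +-identityʳ f = f-free
    fresh (suc j) with elemᵇ (f + suc j * μ) W in e
    ... | false = refl
    ... | true with supported I _ e
    ... | inj₁ all-before = ⊥-elim (true≢false (all-before f f<) f-free)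
      where
      f< : f < f + suc j * μ
      f< = subst (_< f + suc j * μ) (+-identityʳ f) (+-monoʳ-< f (≤-trans μ≥1 (m≤m+n μ (j * μ))))
    ... | inj₂ (_ , e₂) = ⊥-elim (true≢false (subst (λ z → elemᵇ z W ≡ true) (step-back j) e₂) (fresh j))

    keep : ∀ y → elemᵇ y W ≡ true → elemᵇ y W' ≡ true
    keep y e = trans (elemᵇ-++ y (apRun f l) W) (∨-introʳ (elemᵇ y (apRun f l)) e)

    new-or-old : ∀ x → elemᵇ x W' ≡ true → (elemᵇ x (apRun f l) ≡ true) ⊎ (elemᵇ x W ≡ true)
    new-or-old x e = ∨-true (elemᵇ x (apRun f l)) (elemᵇ x W) (trans (sym (elemᵇ-++ x (apRun f l) W)) e)

    size' : countBelow (λ x → elemᵇ x W') (c + l + σ') ≡ c + l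
    size' = trans (sumTo-cong (c + l + σ') (λ k _ → cong ind (elemᵇ-++ k (apRun f l) W)))
            (trans (countBelow-∨ (λ x → elemᵇ x (apRun f l)) (λ x → elemᵇ x W) (c + l + σ') disjoint)
            (trans (cong₂ _+_ (countBelow-apRun f l (c + l + σ') within) old) (+-comm l c)))
      where
      disjoint : ∀ x → (elemᵇ x (apRun f l) ∧ elemᵇ x W) ≡ false
      disjoint x with elemᵇ x (apRun f l) in en
      ... | false = refl
      ... | true with apRun-sound f l x en
      ... | j , _ , refl = fresh j
      old : countBelow (λ x → elemᵇ x W) (c + l + σ') ≡ c
      old = trans (cong (countBelow (λ x → elemᵇ x W)) (sym (m+[n∸m]≡n old-within)))
              (trans (countBelow-beyond (λ x → elemᵇ x W) (c + σ) _ (bounded I)) (size I))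

    supported' : ∀ x → elemᵇ x W' ≡ true →
                 (∀ y → y < x → elemᵇ y W' ≡ true) ⊎ (μ ≤ x × elemᵇ (x ∸ μ) W' ≡ true)
    supported' x e with new-or-old x e
    ... | inj₁ en with apRun-sound f l x en
    ... | zero , _ , refl = inj₁ (λ y y<x → keep y (before-f y (subst (y <_) (+-identityʳ f) y<x)))
    ... | suc j , j<l , refl =
          inj₂ (≤-trans (m≤m+n μ (j * μ)) (m≤n+m _ f) ,
                trans (elemᵇ-++ _ (apRun f l) W)
                  (∨-introˡ (elemᵇ _ W) (subst (λ z → elemᵇ z (apRun f l) ≡ true) (sym (step-back j))
                    (apRun-intro f l j (<-trans (n<1+n j) j<l)))))
    supported' x e | inj₂ eo with supported I x eo
    ... | inj₁ all-before = inj₁ (λ y y<x → keep y (all-before y y<x))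
    ... | inj₂ (μ≤x , e₂) = inj₂ (μ≤x , keep _ e₂)

    inv' : Inv W' (c + l) σ'
    inv' = record { bounded = bounded' ; size = size' ; supported = supported' }
      where
      bounded' : ∀ x → elemᵇ x W' ≡ true → x < c + l + σ'
      bounded' x e with new-or-old x e
      ... | inj₂ eo = <-≤-trans (bounded I x eo) old-within
      ... | inj₁ en with apRun-sound f l x en
      ... | j , j<l , refl = within j j<l

  -- the covered list cov, read from origin o, is [0, a) followed by a + W
  Aligned : ℕ → ℕ → List ℕ → List ℕ → Set
  Aligned o a W cov = ∀ k → k < n → elemᵇ ((o + k) % n) cov ≡ ((k <ᵇ a) ∨ elemᵇ (k ∸ a) W)

  firstFree-aligned : ∀ o a W cov f → Aligned o a W cov → a + f < n →
    elemᵇ f W ≡ false → (∀ j → j < f → elemᵇ j W ≡ true) → firstFree n o cov ≡ ((o + a) % n + f) % n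
  firstFree-aligned o a W cov f M af<n f-free before-f =
    trans (cong (λ xs → findFirst (λ x → not (elemᵇ x cov)) xs o) (map-upTo (λ k → (o + k) % n) n))
    (trans (findFirst-at (λ x → not (elemᵇ x cov)) (λ k → (o + k) % n) o n (a + f) af<n free-at covered-before)
     (trans (cong (_% n) (sym (+-assoc o a f))) (sym (%-+ˡ (o + a) f))))
    where
    free-at : not (elemᵇ ((o + (a + f)) % n) cov) ≡ true
    free-at rewrite M (a + f) af<n | <ᵇ-false {a + f} {a} (m≤m+n a f) | m+n∸m≡n a f | f-free = refl
    covered-before : ∀ j → j < a + f → not (elemᵇ ((o + j) % n) cov) ≡ false
    covered-before j j< rewrite M j (<-trans j< af<n) with j <ᵇ a in e
    ... | true = refl
    ... | false rewrite before-f (j ∸ a) (subst (j ∸ a <_) (m+n∸m≡n a f) (∸-monoˡ-< j< (<ᵇ-sound-false j a e))) = refl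

  Aligned-step : ∀ o a W cov f l → o < n → Aligned o a W cov → (∀ j → j < l → a + (f + j * μ) < n) →
    Aligned o a (apRun f l ++ W) (blockElems n μ (((o + a) % n + f) % n , l) ++ cov)
  Aligned-step o a W cov f l o<n M fits k k<n =
    trans (elemᵇ-++ ((o + k) % n) (blockElems n μ (hd , l)) cov)
    (trans (cong₂ _∨_ in-block (M k k<n))
    (trans (regroup (k <ᵇ a) (elemᵇ (k ∸ a) (apRun f l)) (elemᵇ (k ∸ a) W))
     (cong ((k <ᵇ a) ∨_) (sym (elemᵇ-++ (k ∸ a) (apRun f l) W)))))
    where
    hd : ℕ
    hd = ((o + a) % n + f) % n
    regroup : ∀ b x y → ((not b ∧ x) ∨ (b ∨ y)) ≡ (b ∨ (x ∨ y))
    regroup true x y = refl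
    regroup false true y = refl
    regroup false false y = refl
    position : ∀ j → (hd + j * μ) % n ≡ (o + (a + (f + j * μ))) % n
    position j = trans (%-+ˡ ((o + a) % n + f) (j * μ))
                   (trans (cong (_% n) (+-assoc ((o + a) % n) f (j * μ))) (shift-+ o a (f + j * μ)))
    in-block : elemᵇ ((o + k) % n) (blockElems n μ (hd , l)) ≡ (not (k <ᵇ a) ∧ elemᵇ (k ∸ a) (apRun f l))
    in-block = trans (any-map (λ y → y ≡ᵇ (o + k) % n) (λ j → (hd + j * μ) % n) (upTo l))
               (trans (applyUpTo-any-cong (λ j → (hd + j * μ) % n ≡ᵇ (o + k) % n) (λ x → x)
                                          (λ z → not (k <ᵇ a) ∧ (z ≡ᵇ (k ∸ a))) (λ j → f + j * μ) l
                        (λ j j<l → trans (cong (_≡ᵇ (o + k) % n) (position j))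
                                     (trans (+-%-≡ᵇ o<n (fits j j<l) k<n) (+-≡ᵇ a (f + j * μ) k))))
                (any-∧ (not (k <ᵇ a)) (λ z → z ≡ᵇ (k ∸ a)) (apRun f l)))

  private
    room : ∀ a c σ l rest → a + (c + (l + rest)) ≤ n → 1 ≤ l → σ ≤ l + rest → (c < n) × (c + σ ≤ n)
    room a c σ l rest bd l≥1 σ≤ =
      <-≤-trans (m<m+n c (<-≤-trans l≥1 (m≤m+n l rest))) c+≤n , ≤-trans (+-monoʳ-≤ c σ≤) c+≤n
      where
      c+≤n : c + (l + rest) ≤ n
      c+≤n = ≤-trans (m≤n+m _ a) bd

  greedy-segment′ : ∀ o a → o < n → ∀ ls W c σ cov r → Inv W c σ → Aligned o a W cov →
    a + (c + total ls) ≤ n → All (1 ≤_) ls → Fine σ ls → σ ≤ total ls →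
    Σ (List ℕ) λ cov' → (psiGo n μ o cov (ls ++ r) ≡ greedyLine ((o + a) % n) W ls ++ psiGo n μ o cov' r)
                        × Aligned o (a + (c + total ls)) [] cov'
  greedy-segment′ o a o<n [] W c σ cov r I M bd _ _ σ≤ with n≤0⇒n≡0 σ≤
  ... | refl = cov , refl , M'
    where
    M' : Aligned o (a + (c + 0)) [] cov
    M' k k<n rewrite +-identityʳ c | M k k<n | Inv-full W c I (k ∸ a) | <ᵇ-split a c k = sym (∨-identityʳ _)
  greedy-segment′ o a o<n (l ∷ ls) W c σ cov r I M bd (l≥1 ∷ ≥1s) (fits , fine) σ≤
    with room a c σ l (total ls) bd l≥1 σ≤
  ... | c<n , cσ≤n with leastFree-spec W c σ I c<n cσ≤n
  ... | f-free , before-f , f≤c = cov'' , eq , M''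
    where
    f : ℕ
    f = leastFree W
    open Step W c σ l I f f-free before-f f≤c
    bd' : a + ((c + l) + total ls) ≤ n
    bd' = subst (_≤ n) (cong (a +_) (sym (+-assoc c l (total ls)))) bd
    block-fits : ∀ j → j < l → a + (f + j * μ) < n
    block-fits j j<l = <-≤-trans (+-monoʳ-< a (<-≤-trans (within j j<l) (+-monoʳ-≤ (c + l) fits))) bd'
    a+f<n : a + f < n
    a+f<n = ≤-<-trans (+-monoʳ-≤ a (subst (_≤ f + 0 * μ) (+-identityʳ f) ≤-refl)) (block-fits 0 l≥1)
    hd : ℕ
    hd = ((o + a) % n + f) % n
    cov' : List ℕ
    cov' = blockElems n μ (hd , l) ++ cov
    rec : Σ (List ℕ) λ cov'' → (psiGo n μ o cov' (ls ++ r) ≡ greedyLine ((o + a) % n) W' ls ++ psiGo n μ o cov'' r)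
                               × Aligned o (a + ((c + l) + total ls)) [] cov''
    rec = greedy-segment′ o a o<n ls W' (c + l) σ' cov' r inv' (Aligned-step o a W cov f l o<n M block-fits) bd' ≥1s fine fits
    cov'' : List ℕ
    cov'' = proj₁ rec
    eq : psiGo n μ o cov (l ∷ ls ++ r) ≡ (hd , l) ∷ (greedyLine ((o + a) % n) W' ls ++ psiGo n μ o cov'' r)
    eq = trans (cong (λ h → (h , l) ∷ psiGo n μ o (blockElems n μ (h , l) ++ cov) (ls ++ r))
                     (firstFree-aligned o a W cov f M a+f<n f-free before-f))
               (cong ((hd , l) ∷_) (proj₁ (proj₂ rec)))
    M'' : Aligned o (a + (c + (l + total ls))) [] cov''
    M'' = subst (λ z → Aligned o (a + z) [] cov'') (+-assoc c l (total ls)) (proj₂ (proj₂ rec))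

  greedy-segment : ∀ o a ls r cov → o < n → a + total ls ≤ n → All (1 ≤_) ls → Fine 0 ls →
    Aligned o a [] cov →
    Σ (List ℕ) λ cov' → (psiGo n μ o cov (ls ++ r) ≡ greedyLine ((o + a) % n) [] ls ++ psiGo n μ o cov' r)
                        × Aligned o (a + total ls) [] cov'
  greedy-segment o a ls r cov o<n bd ≥1s fine M = greedy-segment′ o a o<n ls [] 0 0 cov r Inv-empty M bd ≥1s fine z≤n

  total-ones : ∀ G → total (replicate G 1) ≡ G
  total-ones zero = refl
  total-ones (suc G) = cong suc (total-ones G)

  Fine-ones : ∀ σ G → σ ≤ G → Fine σ (replicate G 1)
  Fine-ones σ zero _ = tt
  Fine-ones σ (suc G) σ≤ = le , Fine-ones (slack σ 1) G (subst (slack σ 1 ≤_) (total-ones G) le)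
    where
    le : slack σ 1 ≤ total (replicate G 1)
    le = subst (_≤ total (replicate G 1)) (sym (⊔-identityʳ (σ ∸ 1)))
           (subst (σ ∸ 1 ≤_) (sym (total-ones G)) (∸-monoˡ-≤ 1 σ≤))

  Fine-++-ones : ∀ L σ ls G → σ ≤ (L ∸ 1) * (μ ∸ 1) → All (_≤ L) ls → (L ∸ 1) * (μ ∸ 1) ≤ G →
                 Fine σ (ls ++ replicate G 1)
  Fine-++-ones L σ [] G σ≤ _ H≤ = Fine-ones σ G (≤-trans σ≤ H≤)
  Fine-++-ones L σ (l ∷ ls) G σ≤ (l≤L ∷ ≤Ls) H≤ = absorbed , Fine-++-ones L (slack σ l) ls G bounded-slack ≤Ls H≤
    where
    bounded-slack : slack σ l ≤ (L ∸ 1) * (μ ∸ 1)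
    bounded-slack = ⊔-lub (≤-trans (m∸n≤m σ l) σ≤) (*-monoˡ-≤ (μ ∸ 1) (∸-monoˡ-≤ 1 l≤L))
    absorbed : slack σ l ≤ total (ls ++ replicate G 1)
    absorbed = ≤-trans bounded-slack (≤-trans H≤ (subst (G ≤_)
                 (sym (trans (sumL-++ (λ x → x) ls (replicate G 1)) (cong (total ls +_) (total-ones G))))
                 (m≤n+m G (total ls))))

module Partition (n : ℕ) .{{_ : NonZero n}} (m : ℕ) (π : List Block) (P : IsAPPartition n m π) where

  open import Data.Bool using (Bool; true; false; _∧_; T)
  open import Data.Bool.Properties using (∧-identityʳ; ∧-zeroʳ)
  open import Data.Nat
  open import Data.Nat.Properties
  open import Data.Nat.DivMod
  open import Data.List using (List; []; _∷_; _++_; map; upTo; replicate; filterᵇ; foldr)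
  open import Data.List.Properties using (map-upTo)
  open import Data.Bool.ListAction using (any)
  open import Data.List.Relation.Unary.All as All using (All; []; _∷_)
  open import Data.List.Relation.Unary.Any using (here; there)
  open import Data.List.Membership.Propositional using (_∈_)
  open import Data.Product using (Σ; _×_; _,_; proj₁; proj₂)
  open import Data.Sum using (inj₁; inj₂)
  open import Data.Empty using (⊥; ⊥-elim)
  open import Relation.Binary.PropositionalEquality using (_≡_; _≢_; refl; sym; trans; cong; cong₂; subst)
  open import Relation.Nullary using (yes; no)
  open import Function using (_∘_)
  open Sums
  open Bools
  open Cyclic n

  wf : All (λ b → (proj₁ b < n) × (1 ≤ proj₂ b)) π
  wf = proj₁ P

  head<n : ∀ {h l} → (h , l) ∈ π → h < n
  head<n i = proj₁ (All.lookup wf i)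

  length≥1 : ∀ {h l} → (h , l) ∈ π → 1 ≤ l
  length≥1 i = proj₂ (All.lookup wf i)

  countL-allElems : ∀ (p : ℕ → Bool) xs → countL p (allElems n m xs) ≡ sumL (countL p ∘ blockElems n m) xs
  countL-allElems p [] = refl
  countL-allElems p (b ∷ bs) =
    trans (sumL-++ (ind ∘ p) (blockElems n m b) (allElems n m bs)) (cong (countL p (blockElems n m b) +_) (countL-allElems p bs))

  countL-covered : ∀ (p : ℕ → Bool) → countL p (allElems n m π) ≡ countBelow p n
  countL-covered p = trans (sumL-↭ (ind ∘ p) (proj₂ P)) (sumL-applyUpTo (ind ∘ p) (λ x → x) n)

  multiplicity≤1 : ∀ y → countL (λ e → e ≡ᵇ y) (allElems n m π) ≤ 1
  multiplicity≤1 y rewrite countL-covered (λ e → e ≡ᵇ y) with y <? n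
  ... | yes y<n = ≤-reflexive (sumTo-point y n y<n)
  ... | no y≮n = ≤-trans (≤-reflexive (sumTo-point-out y n (≮⇒≥ y≮n))) z≤n

  head∈block : ∀ h l → h < n → 1 ≤ l → elemᵇ h (blockElems n m (h , l)) ≡ true
  head∈block h (suc l) h<n _ rewrite +-identityʳ h | m<n⇒m%n≡m h<n | ≡ᵇ-refl h = refl

  elem∈block : ∀ h l j → j < l → elemᵇ ((h + j * m) % n) (blockElems n m (h , l)) ≡ true
  elem∈block h l j j<l =
    trans (any-map (λ y → y ≡ᵇ ((h + j * m) % n)) (λ j → (h + j * m) % n) (upTo l))
      (applyUpTo-any-intro (λ j' → (h + j' * m) % n ≡ᵇ (h + j * m) % n) (λ x → x) l j j<l (≡ᵇ-refl ((h + j * m) % n)))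

  blocks-disjoint : ∀ {b₁ b₂ y} → b₁ ∈ π → b₂ ∈ π → b₁ ≢ b₂ →
    elemᵇ y (blockElems n m b₁) ≡ true → elemᵇ y (blockElems n m b₂) ≡ true → ⊥
  blocks-disjoint {b₁} {b₂} {y} i₁ i₂ b₁≢b₂ e₁ e₂ = <⇒≱ (s≤s (s≤s z≤n)) (≤-trans twice (multiplicity≤1 y))
    where
    twice : 2 ≤ countL (λ e → e ≡ᵇ y) (allElems n m π)
    twice = ≤-trans (+-mono-≤ (countL-any _ (blockElems n m b₁) e₁) (countL-any _ (blockElems n m b₂) e₂))
              (≤-trans (sumL-∈₂ (countL (λ e → e ≡ᵇ y) ∘ blockElems n m) i₁ i₂ b₁≢b₂)
                (≤-reflexive (sym (countL-allElems (λ e → e ≡ᵇ y) π))))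

  heads-unique : ∀ x → countL (λ b → proj₁ b ≡ᵇ x) π ≤ 1
  heads-unique x =
    ≤-trans (sumL-monoᴬ π (All.map head-counted wf))
      (≤-trans (≤-reflexive (sym (countL-allElems (λ e → e ≡ᵇ x) π))) (multiplicity≤1 x))
    where
    head-counted : ∀ {b} → (proj₁ b < n) × (1 ≤ proj₂ b) → ind (proj₁ b ≡ᵇ x) ≤ countL (λ e → e ≡ᵇ x) (blockElems n m b)
    head-counted {h , l} (h<n , l≥1) with h ≡ᵇ x in e
    ... | false = z≤n
    ... | true with ≡ᵇ-sound h x e
    ... | refl = countL-any _ (blockElems n m (h , l)) (head∈block h l h<n l≥1)

  count-heads : ∀ (c : Block → Bool) → countBelow (λ x → any (λ b → (proj₁ b ≡ᵇ x) ∧ c b) π) n ≡ countL c π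
  count-heads c =
    trans (sumTo-cong n (λ x _ → sym (countL≤1 _ π (≤-trans (sumL-monoᴬ π (All.tabulate (λ {b} _ → ind-∧≤ (proj₁ b ≡ᵇ x) (c b))))
                                                              (heads-unique x)))))
    (trans (sumTo-sumL (λ b x → ind ((proj₁ b ≡ᵇ x) ∧ c b)) π n)
    (sumL-congᴬ π (All.map (λ {b} w → count-one b (proj₁ w)) wf)))
    where
    ind-∧≤ : ∀ a b → ind (a ∧ b) ≤ ind a
    ind-∧≤ true b = ind≤1 b
    ind-∧≤ false b = z≤n
    count-one : ∀ b → proj₁ b < n → sumTo (λ x → ind ((proj₁ b ≡ᵇ x) ∧ c b)) n ≡ ind (c b)
    count-one b h<n with c b
    ... | true = trans (sumTo-cong n (λ x _ → cong ind (trans (∧-identityʳ _) (≡ᵇ-sym (proj₁ b) x))))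
                       (sumTo-point (proj₁ b) n h<n)
    ... | false = sumTo-zero n (λ x _ → cong ind (∧-zeroʳ _))

  nsHead : ℕ → Bool
  nsHead = isNonSingHead π

  single : ℕ → Bool
  single = isSingleton π

  single-sound : ∀ y → single y ≡ true → (y , 1) ∈ π
  single-sound y e with any-sound _ π e
  ... | (h , l) , i , q with h ≡ᵇ y in e₁ | l ≡ᵇ 1 in e₂
  ... | true | true rewrite ≡ᵇ-sound h y e₁ | ≡ᵇ-sound l 1 e₂ = i

  nsHead-sound : ∀ x → nsHead x ≡ true → Σ ℕ λ l → (x , l) ∈ π × 2 ≤ l
  nsHead-sound x e with any-sound _ π e
  ... | (h , l) , i , q with h ≡ᵇ x in e₁ | 2 ≤ᵇ l in e₂
  ... | true | true rewrite ≡ᵇ-sound h x e₁ = l , i , ≤ᵇ⇒≤ 2 l (subst T (sym e₂) _)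

  nsHead-intro : ∀ h l → (h , l) ∈ π → 2 ≤ l → nsHead h ≡ true
  nsHead-intro h l i l≥2 = any-intro _ i (trans (cong (_∧ (2 ≤ᵇ l)) (≡ᵇ-refl h)) (T-true (≤⇒≤ᵇ l≥2)))
    where
    T-true : ∀ {b} → T b → b ≡ true
    T-true {true} _ = refl

  nsHead⇒¬single : ∀ x → nsHead x ≡ true → single x ≡ false
  nsHead⇒¬single x e with single x in e'
  ... | false = refl
  ... | true with nsHead-sound x e
  ... | l , i , l≥2 = ⊥-elim (<⇒≱ (s≤s (s≤s z≤n)) (≤-trans twice (heads-unique x)))
    where
    different : (x , l) ≢ (x , 1)
    different eq = <⇒≢ l≥2 (sym (cong proj₂ eq))
    twice : 2 ≤ countL (λ b → proj₁ b ≡ᵇ x) π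
    twice = subst (_≤ countL (λ b → proj₁ b ≡ᵇ x) π) (cong (λ z → ind z + ind z) (≡ᵇ-refl x))
              (sumL-∈₂ (λ b → ind (proj₁ b ≡ᵇ x)) i (single-sound x e') different)

  lengthsAt : ℕ → List ℕ
  lengthsAt x = map proj₂ (filterᵇ (λ b → proj₁ b ≡ᵇ x) π)

  lengthsAt-ones : ∀ x → nsHead x ≡ false → lengthsAt x ≡ replicate (ind (single x)) 1
  lengthsAt-ones x e = trans (only-ones π all-one) (cong (λ z → replicate z 1) count-single)
    where
    only-ones : ∀ xs → All (λ b → (proj₁ b ≡ᵇ x) ≡ true → proj₂ b ≡ 1) xs →
      map proj₂ (filterᵇ (λ b → proj₁ b ≡ᵇ x) xs) ≡ replicate (countL (λ b → proj₁ b ≡ᵇ x) xs) 1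
    only-ones [] _ = refl
    only-ones ((h , l) ∷ xs) (a ∷ as) with h ≡ᵇ x in e
    ... | true = cong₂ _∷_ (a refl) (only-ones xs as)
    ... | false = only-ones xs as
    one : ∀ {b} → (proj₁ b < n) × (1 ≤ proj₂ b) → ((proj₁ b ≡ᵇ x) ∧ (2 ≤ᵇ proj₂ b)) ≡ false →
          (proj₁ b ≡ᵇ x) ≡ true → proj₂ b ≡ 1
    one {h , 1} _ _ _ = refl
    one {h , suc (suc l)} _ not-ns at-x rewrite at-x with not-ns
    ... | ()
    all-one : All (λ b → (proj₁ b ≡ᵇ x) ≡ true → proj₂ b ≡ 1) π
    all-one = All.zipWith (λ {b} p → one {b} (proj₁ p) (proj₂ p)) (wf , any-false _ π e)
    same-count : countL (λ b → proj₁ b ≡ᵇ x) π ≡ countL (λ b → (proj₁ b ≡ᵇ x) ∧ (proj₂ b ≡ᵇ 1)) π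
    same-count = sumL-congᴬ π (All.map (λ {b} → agree {b}) all-one)
      where
      agree : ∀ {b} → ((proj₁ b ≡ᵇ x) ≡ true → proj₂ b ≡ 1) → ind (proj₁ b ≡ᵇ x) ≡ ind ((proj₁ b ≡ᵇ x) ∧ (proj₂ b ≡ᵇ 1))
      agree {h , l} is-one with h ≡ᵇ x in eh
      ... | false = refl
      ... | true rewrite is-one refl = refl
    count-single : countL (λ b → proj₁ b ≡ᵇ x) π ≡ ind (single x)
    count-single = trans same-count (countL≤1 _ π (subst (_≤ 1) same-count (heads-unique x)))

  total-lengthsAt : ∀ x xs → sumL (λ y → y) (map proj₂ (filterᵇ (λ b → proj₁ b ≡ᵇ x) xs))
                             ≡ sumL (λ b → ind (proj₁ b ≡ᵇ x) * proj₂ b) xs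
  total-lengthsAt x [] = refl
  total-lengthsAt x ((h , l) ∷ xs) with h ≡ᵇ x
  ... | true = cong₂ _+_ (sym (+-identityʳ l)) (total-lengthsAt x xs)
  ... | false = total-lengthsAt x xs

  All-lengthsAt : ∀ {Q : ℕ → Set} x → All (Q ∘ proj₂) π → All Q (lengthsAt x)
  All-lengthsAt {Q} x = go π
    where
    go : ∀ xs → All (Q ∘ proj₂) xs → All Q (map proj₂ (filterᵇ (λ b → proj₁ b ≡ᵇ x) xs))
    go [] _ = []
    go ((h , l) ∷ xs) (q ∷ qs) with h ≡ᵇ x
    ... | true = q ∷ go xs qs
    ... | false = go xs qs

  arcLengths : ℕ → ℕ → List ℕ
  arcLengths x len = concatTo (λ k → lengthsAt ((x + k) % n)) len

  lengthsFrom-arc : ∀ s → lengthsFrom n π s ≡ arcLengths s n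
  lengthsFrom-arc s = trans (cong (foldr (λ x acc → lengthsAt x ++ acc) []) (map-upTo (λ k → (s + k) % n) n))
                            (as-concat (λ k → (s + k) % n) n)
    where
    as-concat : ∀ h N → foldr (λ x acc → lengthsAt x ++ acc) [] (Data.List.applyUpTo h N)
                        ≡ concatTo (λ k → lengthsAt (h k)) N
    as-concat h zero = refl
    as-concat h (suc N) = cong (lengthsAt (h 0) ++_) (as-concat (h ∘ suc) N)

  distPrev-spec : ∀ t z → t < n → z < n → nsHead z ≡ true →
    Σ ℕ λ d → (1 ≤ d) × (d ≤ n) × (nsHead (minusMod n t d) ≡ true)
             × (∀ j → 1 ≤ j → j < d → nsHead (minusMod n t j) ≡ false) × (distPrev n π t ≡ d)
  distPrev-spec t z t<n z<n ns-z with findFirst-spec (λ j → nsHead (minusMod n t j)) suc n n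
  ... | inj₁ (_ , none) = ⊥-elim (true≢false ns-z (subst (λ w → nsHead w ≡ false) back-to-z (none (n ∸ suc o) n∸1+o<n)))
    where
    o : ℕ
    o = dist t z
    n∸1+o<n : n ∸ suc o < n
    n∸1+o<n = ∸-monoʳ-< {n} {suc o} {0} z<s (dist<n t z)
    back-to-z : minusMod n t (suc (n ∸ suc o)) ≡ z
    back-to-z = trans (cong (minusMod n t) (sym (+-∸-assoc 1 (dist<n t z))))
                  (trans (minusMod-∸ t (<⇒≤ (dist<n t z))) (+-dist t<n z<n))
  ... | inj₂ (r , r<n , found , earlier , eq) =
    suc r , s≤s z≤n , r<n , found , (λ { (suc j) _ (s≤s j<r) → earlier j j<r }) ,
    trans (cong (λ xs → findFirst (λ j → nsHead (minusMod n t j)) xs n) (map-upTo suc n)) eq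

  g-formula : ∀ t → g n π t ≡ sumTo (λ k → ind (single (minusMod n t (suc k)))) (distPrev n π t)
  g-formula t =
    trans (length-filterᵇ (λ j → single (minusMod n t j)) (map suc (upTo d)))
      (trans (sumL-map (λ j → ind (single (minusMod n t j))) suc (upTo d))
        (sumL-applyUpTo (λ j → ind (single (minusMod n t (suc j)))) (λ x → x) d))
    where d = distPrev n π t

  head-block : ∀ {xs : List Block} {t} → IsHead xs t → Σ ℕ λ l → (t , l) ∈ xs
  head-block (here refl) = _ , here refl
  head-block (there p) with head-block p
  ... | l , i = l , there i

  head-of : ∀ {xs : List Block} {h l} → (h , l) ∈ xs → IsHead xs h
  head-of (here refl) = here refl
  head-of (there p) = there (head-of p)

module NoCrossing (n : ℕ) .{{_ : NonZero n}} (m : ℕ) (m≥1 : 1 ≤ m) (π : List Block) (P : IsAPPartition n m π) where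

  open import Data.Bool using (Bool; true; false; _∧_; _∨_)
  open import Data.Nat
  open import Data.Nat.Properties
  open import Data.Nat.DivMod
  open import Data.List.Membership.Propositional using (_∈_)
  open import Data.Product using (_,_; proj₁; proj₂)
  open import Data.Sum using (inj₁; inj₂)
  open import Data.Empty using (⊥; ⊥-elim)
  open import Relation.Binary.PropositionalEquality using (_≡_; _≢_; sym; trans; cong; cong₂; subst)
  open import Relation.Nullary using (yes; no)
  open Sums
  open Bools
  open Cyclic n
  open Partition n m π P
  open Greedy n m m≥1 using (apRun; apRun-sound; countBelow-apRun)

  -- the span of a block of length l covers (l − 1)m + 1 consecutive places of
  -- which only (l − 1)(m − 1) are outside the block
  span-gaps : ∀ l → 1 ≤ l → (Q : ℕ → Bool) → (∀ u → Q u ≡ true → elemᵇ u (apRun 0 l) ≡ true → ⊥) →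
              countBelow Q (suc ((l ∸ 1) * m)) ≤ (l ∸ 1) * (m ∸ 1)
  span-gaps (suc l') _ Q off-block = subst (countBelow Q N ≤_) N∸l (subst (_≤ N ∸ suc l') (m+n∸n≡m _ (suc l'))
                                       (∸-monoˡ-≤ (suc l') with-block))
    where
    N : ℕ
    N = suc (l' * m)
    in-span : ∀ j → j < suc l' → 0 + j * m < N
    in-span j j<l = s≤s (*-monoˡ-≤ m (≤-pred j<l))
    at-most-one : ∀ u → u < N → ind (Q u) + ind (elemᵇ u (apRun 0 (suc l'))) ≤ 1
    at-most-one u _ with Q u in q | elemᵇ u (apRun 0 (suc l')) in b
    ... | false | _ = ind≤1 _
    ... | true | false = s≤s z≤n
    ... | true | true = ⊥-elim (off-block u q b)
    with-block : countBelow Q N + suc l' ≤ N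
    with-block = subst (_≤ N) (trans (sumTo-+ (λ u → ind (Q u)) (λ u → ind (elemᵇ u (apRun 0 (suc l')))) N)
                                     (cong (countBelow Q N +_) (countBelow-apRun 0 (suc l') N in-span)))
                   (sumTo-≤ N at-most-one)
    N∸l : N ∸ suc l' ≡ l' * (m ∸ 1)
    N∸l = sym (trans (*-distribˡ-∸ l' m 1) (cong (l' * m ∸_) (*-identityʳ l')))

  -- Fix a head t and a non-singleton head h ≠ t at distance j₀ behind t.  The
  -- witnesses of g(t) — t itself and the singletons counted by g(t) — are the
  -- places h + u with witness u, and there are g(t) + 1 of them with u ≤ j₀.
  module Witnesses (t h : ℕ) (t<n : t < n) (h<n : h < n) (ns-h : nsHead h ≡ true) (h≢t : h ≢ t) where

    o j₀ d : ℕ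
    o = dist t h
    j₀ = n ∸ o
    d = distPrev n π t

    witness : ℕ → Bool
    witness u = (u ≡ᵇ j₀) ∨ ((u <ᵇ j₀) ∧ (((j₀ ∸ u) <ᵇ suc d) ∧ single (minusMod n t (j₀ ∸ u))))

    o<n : o < n
    o<n = dist<n t h

    from-t : ∀ u → (h + u) % n ≡ (t + (o + u)) % n
    from-t u = trans (cong (λ z → (z + u) % n) (sym (+-dist t<n h<n))) (shift-+ t o u)

    position : ∀ u → u ≤ j₀ → minusMod n t (j₀ ∸ u) ≡ (h + u) % n
    position u u≤j₀ = trans (cong (λ z → (t + (n ∸ z)) % n) (∸-+-assoc n o u))
                        (trans (cong (λ z → (t + z) % n) (m∸[m∸n]≡n o+u≤n)) (sym (from-t u)))
      where
      o+u≤n : o + u ≤ n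
      o+u≤n = subst (o + u ≤_) (m+[n∸m]≡n (<⇒≤ o<n)) (+-monoʳ-≤ o u≤j₀)

    reaches-t : (h + j₀) % n ≡ t
    reaches-t = trans (from-t j₀) (trans (cong (λ z → (t + z) % n) (m+[n∸m]≡n (<⇒≤ o<n)))
                  (trans ([m+n]%n≡m%n t n) (m<n⇒m%n≡m t<n)))

    -- h is a non-singleton head j₀ places behind t, so the previous one is not farther
    d≤j₀ : d ≤ j₀
    d≤j₀ with distPrev-spec t h t<n h<n ns-h
    ... | d' , _ , _ , _ , none-before , d≡d' with d' ≤? j₀
    ... | yes d'≤j₀ = subst (_≤ j₀) (sym d≡d') d'≤j₀
    ... | no d'≰j₀ = ⊥-elim (true≢false (trans (cong nsHead h-back) ns-h) (none-before j₀ (m<n⇒0<n∸m o<n) (≰⇒> d'≰j₀)))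
      where
      h-back : minusMod n t j₀ ≡ h
      h-back = trans (minusMod-∸ t (<⇒≤ o<n)) (+-dist t<n h<n)

    witness-count : countBelow witness (suc j₀) ≡ suc (g n π t)
    witness-count = trans (sumTo-snoc (λ u → ind (witness u)) j₀)
                      (trans (cong₂ _+_ singletons (cong (λ b → ind (b ∨ ((j₀ <ᵇ j₀) ∧ counted (j₀ ∸ j₀)))) (≡ᵇ-refl j₀))) (+-comm (g n π t) 1))
      where
      counted : ℕ → Bool
      counted j = (j <ᵇ suc d) ∧ single (minusMod n t j)
      singletons : countBelow witness j₀ ≡ g n π t
      singletons =
        trans (sumTo-cong j₀ (λ u u<j₀ → trans (cong₂ (λ a b → ind (a ∨ (b ∧ counted (j₀ ∸ u)))) (≡ᵇ-false (<⇒≢ u<j₀)) (<ᵇ-true u<j₀))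
                                                (cong (λ z → ind (counted z)) (+-∸-assoc 1 u<j₀))))
        (trans (sumTo-reverse (λ k → ind (counted (suc k))) j₀)
        (trans (cong (sumTo (λ k → ind (counted (suc k)))) (sym (m+[n∸m]≡n d≤j₀)))
        (trans (sumTo-split (λ k → ind (counted (suc k))) d (j₀ ∸ d))
        (trans (cong₂ _+_ (sumTo-cong d (λ k k<d → cong (λ b → ind (b ∧ single (minusMod n t (suc k)))) (<ᵇ-true k<d)))
                          (sumTo-zero (j₀ ∸ d) (λ k _ → cong (λ b → ind (b ∧ single (minusMod n t (suc (d + k))))) (<ᵇ-false (m≤m+n d k)))))
        (trans (+-identityʳ _) (sym (g-formula t)))))))

  no-crossing : ∀ t → IsHead π t → ∀ h l → (h , l) ∈ π → h ≢ t → (l ∸ 1) * (m ∸ 1) ≤ g n π t →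
                dist t h + (l ∸ 1) * m < n
  no-crossing t t-head h zero hl _ _ = ⊥-elim (<⇒≱ z<s (length≥1 hl))
  no-crossing t t-head h 1 hl _ _ = subst (_< n) (sym (+-identityʳ _)) (dist<n t h)
  no-crossing t t-head h l@(suc (suc l')) hl h≢t g-big with dist t h + suc l' * m <? n
  ... | yes fits = fits
  ... | no crosses = ⊥-elim (<⇒≱ (s≤s ≤-refl) (≤-trans too-many (≤-trans (span-gaps l (s≤s z≤n) witness off-block) g-big)))
    where
    t-block : (t , proj₁ (head-block t-head)) ∈ π
    t-block = proj₂ (head-block t-head)
    open Witnesses t h (head<n t-block) (head<n hl) (nsHead-intro h l hl (s≤s (s≤s z≤n))) h≢t
    j₀≤span : j₀ ≤ suc l' * m
    j₀≤span = subst (j₀ ≤_) (m+n∸m≡n o _) (∸-monoˡ-≤ o (≮⇒≥ crosses))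
    too-many : suc (g n π t) ≤ countBelow witness (suc (suc l' * m))
    too-many = subst (_≤ countBelow witness (suc (suc l' * m))) witness-count
                 (subst (countBelow witness (suc j₀) ≤_) (cong (countBelow witness) (m+[n∸m]≡n (s≤s j₀≤span)))
                   (sumTo-monoᴺ (λ u → ind (witness u)) (suc j₀) _))
    -- a witness place is t or a singleton, hence not in the block of h
    off-block : ∀ u → witness u ≡ true → elemᵇ u (apRun 0 l) ≡ true → ⊥
    off-block u is-witness in-run with apRun-sound 0 l u in-run
    ... | q , q<l , qm≡u = case (∨-true (u ≡ᵇ j₀) _ is-witness)
      where
      in-block : elemᵇ ((h + u) % n) (blockElems n m (h , l)) ≡ true
      in-block = subst (λ z → elemᵇ ((h + z) % n) (blockElems n m (h , l)) ≡ true) qm≡u (elem∈block h l q q<l)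
      case : _ → ⊥
      case (inj₁ u≡j₀) =
        blocks-disjoint hl t-block (λ eq → h≢t (cong proj₁ eq))
          (subst (λ z → elemᵇ z (blockElems n m (h , l)) ≡ true)
                 (trans (cong (λ z → (h + z) % n) (≡ᵇ-sound u j₀ u≡j₀)) reaches-t) in-block)
          (head∈block t _ (head<n t-block) (length≥1 t-block))
      case (inj₂ e) with ∧-true {u <ᵇ j₀} e
      ... | u<j₀ , near-single with ∧-true {(j₀ ∸ u) <ᵇ suc d} near-single
      ... | _ , is-single =
        blocks-disjoint hl (single-sound _ is-single) (λ eq → <⇒≢ (s≤s (s≤s z≤n)) (sym (cong proj₂ eq)))
          (subst (λ z → elemᵇ z (blockElems n m (h , l)) ≡ true) (sym (position u (<⇒≤ (<ᵇ-sound u j₀ u<j₀)))) in-block)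
          (head∈block _ 1 (m%n<n _ n) (s≤s z≤n))

module Arcs (n : ℕ) .{{_ : NonZero n}} (m : ℕ) (π : List Block) (P : IsAPPartition n m π) where

  open import Data.Bool using (Bool; true; false)
  open import Data.Nat
  open import Data.Nat.Properties
  open import Data.Nat.DivMod
  open import Data.List using (List; []; _++_; upTo; replicate)
  open import Data.List.Relation.Unary.All as All using (All)
  open import Data.List.Membership.Propositional using (_∈_)
  open import Data.Product using (Σ; _×_; _,_; proj₁; proj₂)
  open import Data.Sum using (_⊎_; inj₁; inj₂)
  open import Relation.Binary.PropositionalEquality using (_≡_; _≢_; refl; sym; trans; cong; subst)
  open import Relation.Nullary using (yes; no)
  open Sums
  open Bools
  open Cyclic n
  open Partition n m π P

  -- t is uncrossed: every block not headed at t lies in the arc t, t+1, …, t−1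
  Uncrossed : ℕ → Set
  Uncrossed t = ∀ h l → (h , l) ∈ π → h ≢ t → dist t h + (l ∸ 1) * m < n

  total-arc-heads : ∀ x len → x < n → len ≤ n →
    sumL (λ y → y) (arcLengths x len) ≡ sumL (λ b → ind (dist x (proj₁ b) <ᵇ len) * proj₂ b) π
  total-arc-heads x len x<n len≤n =
    trans (sumL-concatTo (λ y → y) (λ k → lengthsAt ((x + k) % n)) len)
    (trans (sumTo-cong len (λ k _ → total-lengthsAt ((x + k) % n) π))
    (trans (sumTo-sumL (λ b k → ind (proj₁ b ≡ᵇ (x + k) % n) * proj₂ b) π len)
    (sumL-congᴬ π (All.map (λ {b} w → trans (sumTo-* (λ k → ind (proj₁ b ≡ᵇ (x + k) % n)) (proj₂ b) len)
                                         (cong (_* proj₂ b) (count-arc x (proj₁ b) len x<n (proj₁ w) len≤n))) wf))))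

  module _ (x len : ℕ) (x<n : x < n) (len<n : len < n) {h l} (hl : (h , l) ∈ π) {j} (j<l : j < l) where

    private
      o : ℕ
      o = dist x h
      element : (h + j * m) % n ≡ (x + (o + j * m)) % n
      element = trans (cong (λ z → (z + j * m) % n) (sym (+-dist x<n (head<n hl)))) (shift-+ x o (j * m))
      jm≤ : j * m ≤ (l ∸ 1) * m
      jm≤ = *-monoˡ-≤ m (subst (j ≤_) (pred[m∸n]≡m∸[1+n] l 0) (<⇒≤pred j<l))

    stays-inside : Uncrossed ((x + len) % n) → dist x h < len → dist x ((h + j * m) % n) < len
    stays-inside y-uncrossed o<len = subst (_< len) (sym (trans (cong (dist x) element) (dist-+ x<n (<-trans o+jm<len len<n)))) o+jm<len
      where
      y k : ℕ
      y = (x + len) % n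
      k = (n ∸ len) + o
      k<n : k < n
      k<n = subst (k <_) (m∸n+n≡m (<⇒≤ len<n)) (+-monoʳ-< (n ∸ len) o<len)
      y+k≡h : (y + k) % n ≡ h
      y+k≡h = trans (shift-+ x len k)
              (trans (cong (λ z → (x + z) % n) (trans (sym (+-assoc len (n ∸ len) o))
                                                 (trans (cong (_+ o) (m+[n∸m]≡n (<⇒≤ len<n))) (+-comm n o))))
              (trans (cong (_% n) (sym (+-assoc x o n))) (trans ([m+n]%n≡m%n (x + o) n) (+-dist x<n (head<n hl)))))
      h≢y : h ≢ y
      h≢y eq = <-irrefl (sym (trans (sym (dist-+ x<n len<n)) (cong (dist x) (sym eq)))) o<len
      fits : k + (l ∸ 1) * m < n
      fits = subst (λ z → z + (l ∸ 1) * m < n) (trans (cong (dist y) (sym y+k≡h)) (dist-+ (m%n<n (x + len) n) k<n))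
               (y-uncrossed h l hl h≢y)
      o+jm<len : o + j * m < len
      o+jm<len = +-cancelˡ-< (n ∸ len) (o + j * m) len
        (subst ((n ∸ len) + (o + j * m) <_) (sym (m∸n+n≡m (<⇒≤ len<n)))
          (≤-<-trans (≤-reflexive (sym (+-assoc (n ∸ len) o (j * m)))) (≤-<-trans (+-monoʳ-≤ k jm≤) fits)))

    stays-outside : Uncrossed x → 1 ≤ len → len ≤ dist x h → len ≤ dist x ((h + j * m) % n)
    stays-outside x-uncrossed len≥1 len≤o = subst (len ≤_) (sym (trans (cong (dist x) element) (dist-+ x<n o+jm<n)))
                                              (≤-trans len≤o (m≤m+n o (j * m)))
      where
      h≢x : h ≢ x
      h≢x eq = <⇒≱ (subst (_< len) (sym (trans (cong (dist x) eq) (dist-self x x<n))) len≥1) len≤o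
      o+jm<n : o + j * m < n
      o+jm<n = ≤-<-trans (+-monoʳ-≤ o jm≤) (x-uncrossed h l hl h≢x)

  total-arc : ∀ x len → x < n → 1 ≤ len → len < n → Uncrossed x → Uncrossed ((x + len) % n) →
              sumL (λ y → y) (arcLengths x len) ≡ len
  total-arc x len x<n len≥1 len<n x-uncrossed y-uncrossed =
    trans (total-arc-heads x len x<n (<⇒≤ len<n))
    (trans (sumL-congᴬ π (All.tabulate (λ {b} i → heads-count-elements b i)))
    (trans (sym (countL-allElems in-arc π))
    (trans (countL-covered in-arc)
    (trans (sumTo-rotate (λ y → ind (in-arc y)) x x<n)
    (trans (sumTo-cong n (λ k k<n → cong (λ z → ind (z <ᵇ len)) (dist-+ x<n k<n)))
    (sumTo-below len n (<⇒≤ len<n)))))))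
    where
    in-arc : ℕ → Bool
    in-arc y = dist x y <ᵇ len
    same-side : ∀ {h l} → (h , l) ∈ π → ∀ j → j < l → in-arc ((h + j * m) % n) ≡ in-arc h
    same-side {h} hl j j<l with dist x h <? len
    ... | yes inside = trans (<ᵇ-true (stays-inside x len x<n len<n hl j<l y-uncrossed inside)) (sym (<ᵇ-true inside))
    ... | no outside = trans (<ᵇ-false (stays-outside x len x<n len<n hl j<l x-uncrossed len≥1 (≮⇒≥ outside)))
                             (sym (<ᵇ-false (≮⇒≥ outside)))
    heads-count-elements : ∀ b → b ∈ π → ind (in-arc (proj₁ b)) * proj₂ b ≡ countL in-arc (blockElems n m b)
    heads-count-elements (h , l) hl =
      sym (trans (sumL-map (λ y → ind (in-arc y)) (λ j → (h + j * m) % n) (upTo l))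
          (trans (sumL-applyUpTo (λ j → ind (in-arc ((h + j * m) % n))) (λ z → z) l)
          (trans (sumTo-cong l (λ j j<l → cong ind (same-side hl j j<l)))
          (trans (sumTo-const (ind (in-arc h)) l) (*-comm l _)))))

  module ArcEnd (x len : ℕ) (len≤n : len ≤ n) (d : ℕ) (d≥1 : 1 ≤ d)
                (ns-d : nsHead (minusMod n ((x + len) % n) d) ≡ true)
                (quiet : ∀ j → 1 ≤ j → j < d → nsHead (minusMod n ((x + len) % n) j) ≡ false)
                (distPrev≡d : distPrev n π ((x + len) % n) ≡ d) where

    y : ℕ
    y = (x + len) % n

    arc : ℕ → List ℕ
    arc k = lengthsAt ((x + k) % n)

    no-head : ∀ k → k < len → len ∸ k < d → nsHead ((x + k) % n) ≡ false
    no-head k k<len near = trans (cong nsHead (+≡minusMod x len k len≤n (<⇒≤ k<len))) (quiet (len ∸ k) (m<n⇒0<n∸m k<len) near)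

    all-ones : len < d → arcLengths x len ≡ replicate (countBelow (λ k → single ((x + k) % n)) len) 1
    all-ones len<d =
      trans (concatTo-cong len (λ k k<len → lengthsAt-ones _ (no-head k k<len (≤-<-trans (m∸n≤m len k) len<d))))
            (concatTo-ones (λ k → single ((x + k) % n)) len)

    module Tail (d≤len : d ≤ len) where

      b a : ℕ
      b = d ∸ 1
      a = len ∸ b

      a+b≡len : a + b ≡ len
      a+b≡len = m∸n+n≡m (≤-trans (m∸n≤m d 1) d≤len)

      d≡1+b : d ≡ suc b
      d≡1+b = trans (sym (m∸n+n≡m d≥1)) (+-comm b 1)

      a+k≤len : ∀ k → k < b → a + k ≤ len
      a+k≤len k k<b = subst (a + k ≤_) a+b≡len (+-monoʳ-≤ a (<⇒≤ k<b))

      back : ∀ k → k < b → len ∸ (a + k) ≡ b ∸ k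
      back k k<b = trans (cong (_∸ (a + k)) (sym a+b≡len)) (trans (sym (∸-+-assoc (a + b) a k)) (cong (_∸ k) (m+n∸m≡n a b)))

      tail-ones : concatTo (λ k → arc (a + k)) b ≡ replicate (countBelow (λ k → single ((x + (a + k)) % n)) b) 1
      tail-ones = trans (concatTo-cong b (λ k k<b → lengthsAt-ones _
                          (no-head (a + k) (subst (a + k <_) a+b≡len (+-monoʳ-< a k<b))
                                   (subst (_< d) (sym (back k k<b)) (subst (b ∸ k <_) (sym d≡1+b) (s≤s (m∸n≤m b k)))))))
                        (concatTo-ones (λ k → single ((x + (a + k)) % n)) b)

      arc-split : arcLengths x len ≡ concatTo arc a ++ concatTo (λ k → arc (a + k)) b
      arc-split = trans (cong (concatTo arc) (sym a+b≡len)) (concatTo-split arc a b)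

      before-y : ℕ → ℕ
      before-y i = ind (single (minusMod n y (suc i)))

      tail-count : countBelow (λ k → single ((x + (a + k)) % n)) b ≡ g n π y
      tail-count =
        trans (sumTo-cong b (λ k k<b → cong (λ w → ind (single w))
                (trans (+≡minusMod x len (a + k) len≤n (a+k≤len k k<b)) (cong (minusMod n y) (trans (back k k<b) (+-∸-assoc 1 k<b))))))
        (trans (sumTo-reverse before-y b)
        (sym (trans (g-formula y) (trans (cong (sumTo before-y) (trans distPrev≡d d≡1+b))
              (trans (sumTo-snoc before-y b)
                (trans (cong (λ w → sumTo before-y b + ind w)
                             (trans (cong (λ w → single (minusMod n y w)) (sym d≡1+b)) (nsHead⇒¬single _ ns-d)))
                       (+-identityʳ _)))))))

  EndsWithGaps : ℕ → ℕ → Set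
  EndsWithGaps x len = Σ (List ℕ) λ front → Σ ℕ λ G' → (arcLengths x len ≡ front ++ replicate G' 1)
                                                      × ((front ≡ []) ⊎ (G' ≡ g n π ((x + len) % n)))

  arc-shape : ∀ x len z → len ≤ n → z < n → nsHead z ≡ true → EndsWithGaps x len
  arc-shape x len z len≤n z<n ns-z with distPrev-spec ((x + len) % n) z (m%n<n (x + len) n) z<n ns-z
  ... | d , d≥1 , _ , ns-d , quiet , distPrev≡d with d ≤? len
  ... | no d≰len = [] , _ , End.all-ones (≰⇒> d≰len) , inj₁ refl
    where module End = ArcEnd x len len≤n d d≥1 ns-d quiet distPrev≡d
  ... | yes d≤len = concatTo End.arc a , _ , trans arc-split (cong (concatTo End.arc a ++_) tail-ones) , inj₂ tail-count
    where
    module End = ArcEnd x len len≤n d d≥1 ns-d quiet distPrev≡d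
    open End.Tail d≤len

-- Step (1): walking around ℤ_n from a non-singleton head z, every singleton
-- is counted by g at the next non-singleton head, so the values of g at the
-- non-singleton heads add up to the number of singletons.
module SingletonCount (n : ℕ) .{{_ : NonZero n}} (m : ℕ) (π : List Block) (P : IsAPPartition n m π)
                      (z : ℕ) (z<n : z < n) (ns-z : isNonSingHead π z ≡ true) where

  open import Data.Bool using (Bool; true; false)
  open import Data.Nat
  open import Data.Nat.Properties
  open import Data.Nat.DivMod
  open import Data.Product using (Σ; _×_; _,_)
  open import Data.Empty using (⊥-elim)
  open import Relation.Binary using (tri<; tri≈; tri>)
  open import Relation.Binary.PropositionalEquality using (_≡_; refl; sym; trans; cong; cong₂; subst)
  open import Relation.Nullary using (yes; no)
  open Sums
  open Bools
  open Cyclic n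
  open Partition n m π P

  ns : ℕ → Bool
  ns k = nsHead ((z + k) % n)

  sg : ℕ → Bool
  sg k = single ((z + k) % n)

  gz : ℕ → ℕ
  gz k = g n π ((z + k) % n)

  singletonsBelow : ℕ → ℕ
  singletonsBelow i = countBelow sg i

  singletonsBelow-split : ∀ K last → last ≤ K → singletonsBelow K ≡ singletonsBelow last + countBelow (λ i → sg (last + i)) (K ∸ last)
  singletonsBelow-split K last le =
    trans (cong singletonsBelow (sym (m+[n∸m]≡n le))) (sumTo-split (λ k → ind (sg k)) last (K ∸ last))

  g-between : ∀ K last → K ≤ n → last < K → ns last ≡ true → (∀ k → last < k → k < K → ns k ≡ false) →
              gz K ≡ countBelow (λ i → sg (last + i)) (K ∸ last)
  g-between K last K≤n last<K ns-last quiet with distPrev-spec ((z + K) % n) z (m%n<n (z + K) n) z<n ns-z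
  ... | d , d≥1 , _ , ns-d , none-before , distPrev≡d =
    trans (g-formula x) (trans (cong (sumTo before-x) (trans distPrev≡d d≡D))
      (trans (sumTo-cong D (λ k k<D → cong (λ w → ind (single w))
                (trans (minusMod≡+ z K (suc k) K≤n (≤-trans k<D (m∸n≤m K last))) (cong (λ w → (z + w) % n) (reindex k k<D)))))
        (sumTo-reverse (λ i → ind (sg (last + i))) D)))
    where
    x D : ℕ
    x = (z + K) % n
    D = K ∸ last
    before-x : ℕ → ℕ
    before-x k = ind (single (minusMod n x (suc k)))
    last+D≡K : last + D ≡ K
    last+D≡K = m+[n∸m]≡n (<⇒≤ last<K)
    reindex : ∀ k → k < D → K ∸ suc k ≡ last + (D ∸ suc k)
    reindex k k<D = trans (cong (_∸ suc k) (sym last+D≡K)) (+-∸-assoc last k<D)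
    ns-at-D : nsHead (minusMod n x D) ≡ true
    ns-at-D = trans (cong nsHead (trans (minusMod≡+ z K D K≤n (m∸n≤m K last))
                                        (cong (λ w → (z + w) % n) (m∸[m∸n]≡n (<⇒≤ last<K))))) ns-last
    d≡D : d ≡ D
    d≡D with <-cmp d D
    ... | tri≈ _ d≡D _ = d≡D
    ... | tri> _ _ D<d = ⊥-elim (true≢false ns-at-D (none-before D (m<n⇒0<n∸m last<K) D<d))
    ... | tri< d<D _ _ =
          ⊥-elim (true≢false ns-d (trans (cong nsHead (minusMod≡+ z K d K≤n (≤-trans (<⇒≤ d<D) (m∸n≤m K last))))
                                    (quiet (K ∸ d) last<K∸d (∸-monoʳ-< {K} {d} {0} d≥1 (≤-trans (<⇒≤ d<D) (m∸n≤m K last))))))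
      where
      last<K∸d : last < K ∸ d
      last<K∸d = subst (_< K ∸ d) (m∸[m∸n]≡n (<⇒≤ last<K)) (∸-monoʳ-< d<D (m∸n≤m K last))

  gAfterZ : ℕ → ℕ
  gAfterZ K' = sumTo (λ k → ind (ns (suc k)) * gz (suc k)) K'

  -- the partial sums telescope to the singletons before the last head so far
  partial-sums : ∀ K' → K' < n → Σ ℕ λ last → (last ≤ K') × (ns last ≡ true)
                 × (∀ k → last < k → k < suc K' → ns k ≡ false) × (gAfterZ K' ≡ singletonsBelow last)
  partial-sums zero _ =
    0 , z≤n , trans (cong nsHead (trans (cong (_% n) (+-identityʳ z)) (m<n⇒m%n≡m z<n))) ns-z ,
    (λ { zero () _ ; (suc k) _ (s≤s ()) }) , refl
  partial-sums (suc K') 1+K'<n with partial-sums K' (<-trans (n<1+n K') 1+K'<n)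
  ... | last , last≤K' , ns-last , quiet , sum≡ with ns (suc K') in e
  ... | false = last , ≤-trans last≤K' (n≤1+n K') , ns-last , quiet' ,
                trans (sumTo-snoc _ K') (trans (cong₂ _+_ sum≡ (cong (λ w → ind w * gz (suc K')) e)) (+-identityʳ _))
    where
    quiet' : ∀ k → last < k → k < suc (suc K') → ns k ≡ false
    quiet' k last<k (s≤s k≤1+K') with k ≟ suc K'
    ... | yes refl = e
    ... | no k≢1+K' = quiet k last<k (s≤s (≤-pred (≤∧≢⇒< k≤1+K' k≢1+K')))
  ... | true = suc K' , ≤-refl , e , (λ k a b → ⊥-elim (<-irrefl refl (<-≤-trans a (≤-pred b)))) ,
        trans (sumTo-snoc _ K')
          (trans (cong₂ _+_ sum≡ (trans (cong (λ w → ind w * gz (suc K')) e) (+-identityʳ _)))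
            (trans (cong (singletonsBelow last +_) (g-between (suc K') last (<⇒≤ 1+K'<n) (s≤s last≤K') ns-last quiet))
              (sym (singletonsBelow-split (suc K') last (≤-trans last≤K' (n≤1+n K'))))))

  g-sum : sumTo (λ k → ind (ns k) * gz k) n ≡ singletonsBelow n
  g-sum = go n refl
    where
    go : ∀ N → N ≡ n → sumTo (λ k → ind (ns k) * gz k) N ≡ singletonsBelow N
    go zero _ = refl
    go (suc n') 1+n'≡n with partial-sums n' (subst (n' <_) 1+n'≡n ≤-refl)
    ... | last , last≤n' , ns-last , quiet , sum≡ =
      trans (cong₂ _+_ (trans (cong (λ w → ind w * gz 0) ns-0) (+-identityʳ _)) sum≡)
        (trans (cong (_+ singletonsBelow last) g-0)
          (trans (+-comm _ (singletonsBelow last)) (sym (singletonsBelow-split (suc n') last (≤-trans last≤n' (n≤1+n n'))))))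
      where
      z+0 : (z + 0) % n ≡ z
      z+0 = trans (cong (_% n) (+-identityʳ z)) (m<n⇒m%n≡m z<n)
      ns-0 : ns 0 ≡ true
      ns-0 = trans (cong nsHead z+0) ns-z
      -- g at z itself counts the singletons after the last head, going round
      g-0 : gz 0 ≡ countBelow (λ i → sg (last + i)) (suc n' ∸ last)
      g-0 = trans (cong (g n π) (trans z+0 (sym (trans (cong (λ w → (z + w) % n) 1+n'≡n)
                                                      (trans ([m+n]%n≡m%n z n) (m<n⇒m%n≡m z<n))))))
                  (g-between (suc n') last (≤-reflexive 1+n'≡n) (s≤s last≤n') ns-last quiet)

  pigeonhole : ∀ G → (∀ x → nsHead x ≡ true → g n π x ≤ G) → countBelow single n ≤ countBelow nsHead n * G
  pigeonhole G g≤G =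
    subst (_≤ countBelow nsHead n * G) (trans g-sum (sym (sumTo-rotate (λ x → ind (single x)) z z<n)))
      (≤-trans (sumTo-mono n termwise)
        (≤-reflexive (trans (sumTo-* (λ k → ind (ns k)) G n) (cong (_* G) (sym (sumTo-rotate (λ x → ind (nsHead x)) z z<n))))))
    where
    termwise : ∀ k → k < n → ind (ns k) * gz k ≤ ind (ns k) * G
    termwise k _ with ns k in e
    ... | false = z≤n
    ... | true = +-monoˡ-≤ 0 (g≤G _ e)

module Separation (n : ℕ) .{{_ : NonZero n}} (m m' : ℕ) (m'≥1 : 1 ≤ m') (π : List Block) (P : IsAPPartition n m π)
                  (L : ℕ) (≤L : All (λ b → proj₂ b ≤ L) π) (z : ℕ) (z<n : z < n) (ns-z : isNonSingHead π z ≡ true) where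

  open import Data.Nat
  open import Data.Nat.Properties
  open import Data.Nat.DivMod
  open import Data.List using (List; []; _++_; replicate)
  open import Data.List.Properties using (++-identityʳ)
  open import Data.List.Relation.Unary.All as All using (All)
  open import Data.List.Relation.Unary.All.Properties using (++⁻ˡ)
  open import Data.List.Membership.Propositional using (_∈_)
  open import Data.List.Relation.Binary.Permutation.Propositional.Properties using (∈-resp-↭; ++-comm)
  open import Data.Product using (_,_; proj₂)
  open import Data.Sum using (_⊎_; inj₁; inj₂)
  open import Data.Empty using (⊥-elim)
  open import Function.Bundles using (mk⇔)
  open import Relation.Binary.PropositionalEquality using (_≡_; _≢_; refl; sym; trans; cong; cong₂; subst)
  open import Relation.Nullary using (yes; no)
  open Sums
  open Cyclic n
  open Partition n m π P
  open Arcs n m π P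
  open Greedy n m' m'≥1 using (Fine; Fine-ones; Fine-++-ones; greedy-segment; greedyLine; total)

  Large : ℕ → Set
  Large t = (L ∸ 1) * (m' ∸ 1) ≤ g n π t

  arc-lengths≥1 : ∀ x len → All (1 ≤_) (arcLengths x len)
  arc-lengths≥1 x len = All-concatTo _ len (λ k _ → All-lengthsAt _ (All.map proj₂ wf))

  arc-lengths≤L : ∀ x len → All (_≤ L) (arcLengths x len)
  arc-lengths≤L x len = All-concatTo _ len (λ k _ → All-lengthsAt _ ≤L)

  arc-fine : ∀ x len → len ≤ n → Large ((x + len) % n) → Fine 0 (arcLengths x len)
  arc-fine x len len≤n g-large with arc-shape x len z len≤n z<n ns-z
  ... | front , G' , shape , ends = subst (Fine 0) (sym shape) (by-cases ends)
    where
    by-cases : (front ≡ []) ⊎ (G' ≡ g n π ((x + len) % n)) → Fine 0 (front ++ replicate G' 1)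
    by-cases (inj₁ refl) = Fine-ones 0 G' z≤n
    by-cases (inj₂ G'≡g) = Fine-++-ones L 0 front G' z≤n (++⁻ˡ front (subst (All (_≤ L)) shape (arc-lengths≤L x len)))
                              (subst (_ ≤_) (sym G'≡g) g-large)

  psi-two-arcs : ∀ x y A B → x < n → total A + total B ≡ n → y ≡ (x + total A) % n →
                 All (1 ≤_) A → All (1 ≤_) B → Fine 0 A → Fine 0 B →
                 psiGo n m' x [] (A ++ B) ≡ greedyLine x [] A ++ greedyLine y [] B
  psi-two-arcs x y A B x<n A+B≡n y≡ ≥1A ≥1B fine-A fine-B
    with greedy-segment x 0 A B [] x<n (≤-trans (m≤m+n (total A) (total B)) (≤-reflexive A+B≡n)) ≥1A fine-A (λ k k<n → refl)
  ... | cov , after-A , aligned with greedy-segment x (0 + total A) B [] cov x<n (≤-reflexive A+B≡n) ≥1B fine-B aligned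
  ... | _ , after-B , _ =
    trans after-A (cong₂ _++_ (cong (λ w → greedyLine w [] A) x+0≡x)
      (trans (cong (psiGo n m' x cov) (sym (++-identityʳ B)))
        (trans after-B (trans (++-identityʳ _) (cong (λ w → greedyLine w [] B) (sym y≡))))))
    where
    x+0≡x : (x + 0) % n ≡ x
    x+0≡x = trans (cong (_% n) (+-identityʳ x)) (m<n⇒m%n≡m x<n)

  lengths-split : ∀ s D → D ≤ n → lengthsFrom n π s ≡ arcLengths s D ++ arcLengths ((s + D) % n) (n ∸ D)
  lengths-split s D D≤n =
    trans (lengthsFrom-arc s)
      (trans (cong (arcLengths s) (sym (m+[n∸m]≡n D≤n)))
        (trans (concatTo-split (λ k → lengthsAt ((s + k) % n)) D (n ∸ D))
          (cong (arcLengths s D ++_) (concatTo-cong (n ∸ D) (λ k _ → cong lengthsAt (sym (shift-+ s D k)))))))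

  psi-split : ∀ x y → x < n → y < n → x ≢ y → Uncrossed x → Uncrossed y → Large x → Large y →
              psi n m' π x ≡ greedyLine x [] (arcLengths x (dist x y)) ++ greedyLine y [] (arcLengths y (dist y x))
  psi-split x y x<n y<n x≢y x-uncrossed y-uncrossed x-large y-large =
    trans (cong (psiGo n m' x []) (trans (lengths-split x D (<⇒≤ D<n)) (cong₂ (λ w k → A ++ arcLengths w k) x+D≡y E≡)))
      (psi-two-arcs x y A B x<n (trans (cong₂ _+_ total-A total-B) D+E≡n) (sym (trans (cong (λ w → (x + w) % n) total-A) x+D≡y))
                    (arc-lengths≥1 x D) (arc-lengths≥1 y E)
                    (arc-fine x D (<⇒≤ D<n) (subst Large (sym x+D≡y) y-large))
                    (arc-fine y E (<⇒≤ E<n) (subst Large (sym y+E≡x) x-large)))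
    where
    D E : ℕ
    D = dist x y
    E = dist y x
    A B : List ℕ
    A = arcLengths x D
    B = arcLengths y E
    D+E≡n : D + E ≡ n
    D+E≡n = dist-turn x<n y<n x≢y
    D<n : D < n
    D<n = dist<n x y
    E<n : E < n
    E<n = dist<n y x
    E≡ : n ∸ D ≡ E
    E≡ = trans (cong (_∸ D) (sym D+E≡n)) (m+n∸m≡n D E)
    x+D≡y : (x + D) % n ≡ y
    x+D≡y = +-dist x<n y<n
    y+E≡x : (y + E) % n ≡ x
    y+E≡x = +-dist y<n x<n
    positive : ∀ {a b} → a + b ≡ n → b < n → 1 ≤ a
    positive {zero} a+b≡n b<n = ⊥-elim (<-irrefl a+b≡n b<n)
    positive {suc _} _ _ = s≤s z≤n
    D≥1 : 1 ≤ D
    D≥1 = positive D+E≡n E<n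
    E≥1 : 1 ≤ E
    E≥1 = positive (trans (+-comm E D) D+E≡n) D<n
    total-A : total A ≡ D
    total-A = total-arc x D x<n D≥1 D<n x-uncrossed (subst Uncrossed (sym x+D≡y) y-uncrossed)
    total-B : total B ≡ E
    total-B = total-arc y E y<n E≥1 E<n y-uncrossed (subst Uncrossed (sym y+E≡x) x-uncrossed)

  psi-independent : ∀ s s' → s < n → s' < n → Uncrossed s → Uncrossed s' → Large s → Large s' →
                    SameBlocks (psi n m' π s) (psi n m' π s')
  psi-independent s s' s<n s'<n s-uncrossed s'-uncrossed s-large s'-large with s ≟ s'
  ... | yes refl = λ b → mk⇔ (λ p → p) (λ p → p)
  ... | no s≢s' = λ b → mk⇔ (λ p → subst (b ∈_) (sym from-s') (∈-resp-↭ (++-comm X Y) (subst (b ∈_) from-s p)))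
                             (λ p → subst (b ∈_) (sym from-s) (∈-resp-↭ (++-comm Y X) (subst (b ∈_) from-s' p)))
    where
    X Y : List Block
    X = greedyLine s [] (arcLengths s (dist s s'))
    Y = greedyLine s' [] (arcLengths s' (dist s' s))
    from-s : psi n m' π s ≡ X ++ Y
    from-s = psi-split s s' s<n s'<n s≢s' s-uncrossed s'-uncrossed s-large s'-large
    from-s' : psi n m' π s' ≡ Y ++ X
    from-s' = psi-split s' s s'<n s<n (λ e → s≢s' (sym e)) s'-uncrossed s-uncrossed s'-large s-large

module TypeCounts where

  open import Data.Bool using (true)
  open import Data.Nat
  open import Data.Nat.Properties
  open import Data.Nat.DivMod
  open import Data.List using (List; []; _∷_; map)
  open import Data.List.Relation.Unary.All as All using (All; _∷_)
  open import Data.List.Relation.Unary.Any using (here; there)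
  open import Data.List.Membership.Propositional using (_∈_)
  open import Data.List.Membership.Propositional.Properties using (∈-map⁻)
  open import Data.Product using (Σ; _×_; _,_; proj₁; proj₂)
  open import Data.Sum using (_⊎_; inj₁; inj₂)
  open import Data.Empty using (⊥-elim)
  open import Relation.Binary.PropositionalEquality using (_≡_; _≢_; refl; sym; trans; cong; subst)
  open Sums
  open Bools

  maxLen-∈ : ∀ {x} ts → x ∈ map proj₁ ts → x ≤ maxLen ts
  maxLen-∈ (p ∷ ts) (here refl) = m≤m⊔n (proj₁ p) _
  maxLen-∈ (p ∷ ts) (there q) = ≤-trans (maxLen-∈ ts q) (m≤n⊔m (proj₁ p) _)

  maxLen≥1 : ∀ ts → ts ≢ [] → All (λ p → (1 < proj₁ p) × (1 ≤ proj₂ p)) ts → 1 ≤ maxLen ts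
  maxLen≥1 [] ts≢[] _ = ⊥-elim (ts≢[] refl)
  maxLen≥1 (p ∷ ts) _ ((1<i , _) ∷ _) = ≤-trans (<⇒≤ 1<i) (m≤m⊔n (proj₁ p) _)

  nonSingCount≡ : ∀ ts → nonSingCount ts ≡ sumL proj₂ ts
  nonSingCount≡ [] = refl
  nonSingCount≡ (p ∷ ts) = cong (proj₂ p +_) (nonSingCount≡ ts)

  ceilDiv-≤ : ∀ k K G → k ≤ K * G → ceilDiv k K ≤ G
  ceilDiv-≤ k zero G _ = z≤n
  ceilDiv-≤ k (suc K) G k≤KG = ≤-pred (m<n*o⇒m/o<n {k + K} {suc G} {suc K} k+K<)
    where
    k+K< : k + K < suc G * suc K
    k+K< = subst (k + K <_) (+-comm (G * suc K) (suc K)) (+-mono-≤-< (subst (k ≤_) (*-comm (suc K) G) k≤KG) (n<1+n K))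

  module _ (n : ℕ) .{{_ : NonZero n}} (m : ℕ) (π : List Block) (P : IsAPPartition n m π)
           (k₁ : ℕ) (ts : List (ℕ × ℕ)) (HT : HasType π k₁ ts) where

    open Partition n m π P

    lengths≤maxLen : 1 ≤ maxLen ts → All (λ b → proj₂ b ≤ maxLen ts) π
    lengths≤maxLen L≥1 = All.map (λ {b} → bounded {b}) (proj₂ (proj₂ HT))
      where
      bounded : ∀ {b : Block} → (proj₂ b ≡ 1) ⊎ (proj₂ b ∈ map proj₁ ts) → proj₂ b ≤ maxLen ts
      bounded (inj₁ l≡1) = subst (_≤ maxLen ts) (sym l≡1) L≥1
      bounded (inj₂ l∈ts) = maxLen-∈ ts l∈ts

    singletons≡k₁ : countBelow single n ≡ k₁
    singletons≡k₁ = trans (count-heads (λ b → proj₂ b ≡ᵇ 1)) (trans (sym (length-filterᵇ (λ b → proj₂ b ≡ᵇ 1) π)) (proj₁ HT))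

    nonSingHeads≤ : countBelow nsHead n ≤ nonSingCount ts
    nonSingHeads≤ =
      ≤-trans (≤-reflexive (count-heads (λ b → 2 ≤ᵇ proj₂ b)))
      (≤-trans (sumL-monoᴬ π (All.map (λ {b} → counted-by-type {b}) (proj₂ (proj₂ HT))))
      (≤-reflexive (trans (sumL-swap (λ b p → ind (proj₂ b ≡ᵇ proj₁ p)) π ts)
        (trans (sumL-congᴬ ts (All.map (λ {p} e → trans (sym (length-filterᵇ (λ b → proj₂ b ≡ᵇ proj₁ p) π)) e) (proj₁ (proj₂ HT))))
          (sym (nonSingCount≡ ts))))))
      where
      counted-by-type : ∀ {b} → (proj₂ b ≡ 1) ⊎ (proj₂ b ∈ map proj₁ ts) →
                        ind (2 ≤ᵇ proj₂ b) ≤ sumL (λ p → ind (proj₂ b ≡ᵇ proj₁ p)) ts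
      counted-by-type (inj₁ l≡1) rewrite l≡1 = z≤n
      counted-by-type {b} (inj₂ l∈ts) with ∈-map⁻ proj₁ l∈ts
      ... | p , p∈ts , l≡i = ≤-trans (ind≤1 _) (subst (_≤ sumL (λ p → ind (proj₂ b ≡ᵇ proj₁ p)) ts)
                                (cong ind (≡ᵇ-true l≡i)) (sumL-∈ (λ p → ind (proj₂ b ≡ᵇ proj₁ p)) p∈ts))

    nonSingleton-head : ValidType k₁ ts → Σ ℕ λ z → (z < n) × (nsHead z ≡ true)
    nonSingleton-head (ts≢[] , _ , valid , _) = from-first ts ts≢[] valid (proj₁ (proj₂ HT))
      where
      from-first : ∀ ts' → ts' ≢ [] → All (λ p → (1 < proj₁ p) × (1 ≤ proj₂ p)) ts' →
                   All (λ p → countLen (proj₁ p) π ≡ proj₂ p) ts' → Σ ℕ λ z → (z < n) × (nsHead z ≡ true)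
      from-first [] ts≢[] _ _ = ⊥-elim (ts≢[] refl)
      from-first (p ∷ _) _ ((1<i , k≥1) ∷ _) (count ∷ _)
        with any-sound (λ b → proj₂ b ≡ᵇ proj₁ p) π
               (any-countL _ π (subst (1 ≤_) (trans (sym count) (length-filterᵇ (λ b → proj₂ b ≡ᵇ proj₁ p) π)) k≥1))
      ... | (h , l) , hl , l≡i = h , head<n hl , nsHead-intro h l hl (subst (1 <_) (sym (≡ᵇ-sound l (proj₁ p) l≡i)) 1<i)

module StartingPoints (n m m' k₁ : ℕ) .{{_ : NonZero n}} (ts : List (ℕ × ℕ)) (m≥1 : 1 ≤ m) (VT : ValidType k₁ ts)
                      (hyp : (m ⊔ m' ∸ 1) * (maxLen ts ∸ 1) ≤ ceilDiv k₁ (nonSingCount ts))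
                      (π : List Block) (P : IsAPPartition n m π) (HT : HasType π k₁ ts) where

  open import Data.Nat.Properties using (≤-trans; ≤-reflexive; *-comm; *-monoˡ-≤; *-monoʳ-≤; ∸-monoˡ-≤)
  open import Data.List.Relation.Unary.All using (lookup)
  open import Data.Product using (_,_)
  open import Relation.Binary.PropositionalEquality using (subst)
  open Partition n m π P
  open TypeCounts
  open NoCrossing n m m≥1 π P using (no-crossing)
  open Arcs n m π P using (Uncrossed)

  L : ℕ
  L = maxLen ts

  ≤L : All (λ b → proj₂ b ≤ L) π
  ≤L = lengths≤maxLen n m π P k₁ ts HT (maxLen≥1 ts (proj₁ VT) (proj₁ (proj₂ (proj₂ VT))))

  z-head : Σ ℕ λ z → (z < n) × (isNonSingHead π z ≡ true)
  z-head = nonSingleton-head n m π P k₁ ts HT VT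

  open SingletonCount n m π P (proj₁ z-head) (proj₁ (proj₂ z-head)) (proj₂ (proj₂ z-head)) using (pigeonhole)

  start<n : ∀ {t} → IsStart n π t → t < n
  start<n (t-head , _) = head<n (proj₂ (head-block t-head))

  -- k₁ ≤ K·g(t) with K ≤ k₂ + ⋯ + k_r, hence (max{m,m'} − 1)(L − 1) ≤ ⌈k₁ / K⌉ ≤ g(t)
  large : ∀ t → IsStart n π t → (m ⊔ m' ∸ 1) * (L ∸ 1) ≤ g n π t
  large t (_ , maximal) = ≤-trans hyp (ceilDiv-≤ k₁ (nonSingCount ts) (g n π t)
    (subst (_≤ nonSingCount ts * g n π t) (singletons≡k₁ n m π P k₁ ts HT)
      (≤-trans (pigeonhole (g n π t) (λ x ns-x → maximal x (head-of (proj₁ (proj₂ (nsHead-sound x ns-x))))))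
               (*-monoˡ-≤ (g n π t) (nonSingHeads≤ n m π P k₁ ts HT)))))

  -- the bound at any step μ ≤ max{m, m'}, in the form used by steps (2) and (4)
  large-for : ∀ μ → μ ≤ m ⊔ m' → ∀ t → IsStart n π t → (L ∸ 1) * (μ ∸ 1) ≤ g n π t
  large-for μ μ≤ t t-start =
    ≤-trans (≤-trans (*-monoʳ-≤ (L ∸ 1) (∸-monoˡ-≤ 1 μ≤)) (≤-reflexive (*-comm (L ∸ 1) _))) (large t t-start)

  -- no block of length l ≤ L crosses a starting point, as (l − 1)(m − 1) ≤ g(t)
  uncrossed : ∀ t → IsStart n π t → Uncrossed t
  uncrossed t t-start h l hl h≢t =
    no-crossing t (proj₁ t-start) h l hl h≢t
      (≤-trans (*-monoˡ-≤ (m ∸ 1) (∸-monoˡ-≤ 1 (lookup ≤L hl))) (large-for m (m≤m⊔n m m') t t-start))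

proposition3 :
    (n m m' k₁ : ℕ) .{{_ : NonZero n}} (ts : List (ℕ × ℕ)) →
    1 ≤ m → 1 ≤ m' →
    ValidType k₁ ts →
    n ≡ typeSize k₁ ts →
    (m ⊔ m' ∸ 1) * (maxLen ts ∸ 1) ≤ ceilDiv k₁ (nonSingCount ts) →
    (π : List Block) → IsAPPartition n m π → HasType π k₁ ts →
    (s s' : ℕ) → IsStart n π s → IsStart n π s' →
    SameBlocks (psi n m' π s) (psi n m' π s')
proposition3 n m m' k₁ ts m≥1 m'≥1 VT _ hyp π P HT s s' s-start s'-start =
  psi-independent s s' (start<n s-start) (start<n s'-start) (uncrossed s s-start) (uncrossed s' s'-start)
                  (large-for m' (m≤n⊔m m m') s s-start) (large-for m' (m≤n⊔m m m') s' s'-start)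
  where
  open StartingPoints n m m' k₁ ts m≥1 VT hyp π P HT
  open Separation n m m' m'≥1 π P L ≤L (proj₁ z-head) (proj₁ (proj₂ z-head)) (proj₂ (proj₂ z-head))
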